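{- Let $p>1$ be an integer. For any integer $n\geq 4$, $ex_p(n,\mathcal{C}^*)=e_p(F_n)$, and $F_n$ is the unique (up to isomorphism) graph on $n$ vertices containing no even cycle whose degree power equals $ex_p(n,\mathcal{C}^*)$.
   Context: All graphs are finite, undirected and simple. For a graph $G$, $e_p(G)=\sum_{v\in V(G)} d_G(v)^p$, where $d_G(v)$ is the degree of $v$. $\mathcal{C}^*$ denotes the family of cycles of even length, and $ex_p(n,\mathcal{C}^*)$ is the maximum of $e_p(G)$ over all graphs $G$ with $n$ vertices containing no cycle of even length as a subgraph. The friendship graph $F_n$ is obtained from the star $S_n$ on $n$ vertices by adding a maximum matching on the set of its leaves. -}

module Defs where

open import Data.Nat using (ℕ; zero; suc; _+_; _*_; _^_; _≤_; _/_; _∸_)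
open import Data.Nat.Divisibility using (_∣_)
open import Data.Bool using (Bool; true; false; if_then_else_; _∧_; _∨_; not)
open import Data.Fin using (Fin; zero; suc; toℕ; inject₁; fromℕ)
open import Data.Fin.Properties using (_≟_)
import Data.Nat.Properties as ℕP
open import Data.List using (List; map; allFin)
open import Data.Nat.ListAction using (sum)
open import Data.Product using (Σ; ∃; _×_; _,_)
open import Function.Definitions using (Injective)
open import Function.Bundles using (_↔_; Inverse)
open import Relation.Binary.PropositionalEquality using (_≡_; refl) renaming (sym to sym≡)
open import Relation.Nullary using (yes; no)
open import Data.Empty using (⊥-elim)
open import Relation.Nullary.Decidable using (⌊_⌋)

record Graph (n : ℕ) : Set where
  field
    adj   : Fin n → Fin n → Bool
    sym   : ∀ i j → adj i j ≡ adj j i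
    irrefl : ∀ i → adj i i ≡ false
open Graph public

degree : ∀ {n} → Graph n → Fin n → ℕ
degree {n} G v = sum (map (λ w → if adj G v w then 1 else 0) (allFin n))

degPow : ∀ {n} → ℕ → Graph n → ℕ
degPow {n} p G = sum (map (λ v → degree G v ^ p) (allFin n))

-- A cycle of length suc m (≥ 3) in G: an injective sequence of vertices
-- f 0, f 1, …, f m with consecutive ones adjacent and f m adjacent to f 0.
record Cycle {n : ℕ} (G : Graph n) (m : ℕ) : Set where
  field
    len≥3  : 2 ≤ m
    vert   : Fin (suc m) → Fin n
    inj    : Injective _≡_ _≡_ vert
    step   : ∀ (i : Fin m) → adj G (vert (inject₁ i)) (vert (suc i)) ≡ true
    close  : adj G (vert (fromℕ m)) (vert zero) ≡ true

HasEvenCycle : ∀ {n} → Graph n → Set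
HasEvenCycle G = ∃ λ m → (2 ∣ suc m) × Cycle G m

-- Friendship graph F_n on Fin n: vertex 0 is the centre of the star S_n,
-- the leaves 1,…,n-1 get the maximum matching {1,2},{3,4},{5,6},…
-- (for even n the leaf n-1 stays unmatched).
friendAdj : ∀ {n} → Fin n → Fin n → Bool
friendAdj i j =
  not ⌊ i ≟ j ⌋ ∧
  ( ⌊ toℕ i ℕP.≟ 0 ⌋ ∨ ⌊ toℕ j ℕP.≟ 0 ⌋ ∨
    ⌊ ((toℕ i ∸ 1) / 2) ℕP.≟ ((toℕ j ∸ 1) / 2) ⌋ )

private
  ≟ℕ-sym : ∀ (a b : ℕ) → ⌊ a ℕP.≟ b ⌋ ≡ ⌊ b ℕP.≟ a ⌋
  ≟ℕ-sym a b with a ℕP.≟ b | b ℕP.≟ a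
  ... | yes _ | yes _ = refl
  ... | no _  | no _  = refl
  ... | yes p | no q  = ⊥-elim (q (sym≡ p))
  ... | no p  | yes q = ⊥-elim (p (sym≡ q))

  ≟F-sym : ∀ {n} (a b : Fin n) → ⌊ a ≟ b ⌋ ≡ ⌊ b ≟ a ⌋
  ≟F-sym a b with a ≟ b | b ≟ a
  ... | yes _ | yes _ = refl
  ... | no _  | no _  = refl
  ... | yes p | no q  = ⊥-elim (q (sym≡ p))
  ... | no p  | yes q = ⊥-elim (p (sym≡ q))

  ∨-comm' : ∀ x y z → (x ∨ y ∨ z) ≡ (y ∨ x ∨ z)
  ∨-comm' false false z = refl
  ∨-comm' false true  z = refl
  ∨-comm' true  false z = refl
  ∨-comm' true  true  z = refl

  friend-sym : ∀ {n} (i j : Fin n) → friendAdj i j ≡ friendAdj j i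
  friend-sym i j
    rewrite ≟F-sym i j
          | ≟ℕ-sym ((toℕ i ∸ 1) / 2) ((toℕ j ∸ 1) / 2)
          | ∨-comm' ⌊ toℕ i ℕP.≟ 0 ⌋ ⌊ toℕ j ℕP.≟ 0 ⌋ ⌊ ((toℕ j ∸ 1) / 2) ℕP.≟ ((toℕ i ∸ 1) / 2) ⌋
          = refl

  friend-irrefl : ∀ {n} (i : Fin n) → friendAdj i i ≡ false
  friend-irrefl i with i ≟ i
  ... | yes _ = refl
  ... | no ¬p = ⊥-elim (¬p refl)

friendship : (n : ℕ) → Graph n
friendship n = record { adj = friendAdj ; sym = friend-sym ; irrefl = friend-irrefl }

_≅_ : ∀ {n} → Graph n → Graph n → Set
_≅_ {n} G H = Σ (Fin n ↔ Fin n) λ σ →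
  ∀ i j → adj G i j ≡ adj H (Inverse.to σ i) (Inverse.to σ j)

-- Vertex sets stay Fin n throughout, so induction runs over a support S ⊆ Fin n containing every
-- non-isolated vertex. A maximal-path argument shows that a graph without even cycles has an
-- isolated vertex, a pendant vertex, or two adjacent vertices u, w of degree 2. Deleting it (or u
-- and w) lowers e_p by an amount expressed through Δ d = (d + 1)^p - d^p, which is increasing in d
-- for p ≥ 2, and the remaining degrees are bounded by |S|; so by induction e_p(G) ≤ φ(|S|) = e_p(F_|S|).
-- When equality holds every estimate is tight: some vertex is adjacent to all others, and the same
-- induction, run backwards, labels S as 0, 1, …, |S| - 1 so that G becomes exactly F_|S|.

module Submission where

open import Defs renaming (sym to adj-comm)
open import Data.Bool using (Bool; true; false; if_then_else_; _∧_; _∨_; not)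
open import Data.Bool.Properties using (∧-comm; ∧-zeroʳ; ∧-identityʳ; not-involutive)
open import Data.Empty using (⊥; ⊥-elim)
open import Data.Fin using (Fin; zero; suc; toℕ; inject₁; fromℕ)
open import Data.Fin.Properties using (_≟_; toℕ-injective; toℕ<n)
import Data.Fin.Properties as Fin
open import Data.List using (List; []; _∷_; map; allFin; tabulate; _++_; length; lookup)
open import Data.List.Properties using (map-tabulate; length-++; ++-assoc)
open import Data.Nat using (ℕ; zero; suc; _+_; _*_; _^_; _≤_; _<_; _∸_; z≤n; s≤s; _/_; ⌊_/2⌋)
open import Data.Nat.DivMod.Core using (divₕ-extractAcc)
open import Data.Nat.Divisibility using (_∣_; divides)
open import Data.Nat.ListAction using (sum)
open import Data.Nat.Properties hiding (_≟_)
import Data.Nat.Properties as ℕ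
open import Data.Nat.Tactic.RingSolver using (solve-∀)
open import Algebra.Properties.CommutativeMonoid.Sum ℕ.+-0-commutativeMonoid
  using (sum-cong-≗; ∑-distrib-+) renaming (sum to ∑)
open import Data.Product using (Σ; _×_; _,_; proj₁; proj₂)
open import Data.Sum using (_⊎_; inj₁; inj₂; [_,_]′)
open import Data.Unit using (⊤; tt)
open import Function using (_∘_; id)
open import Function.Bundles using (_↔_; Inverse; mk↔ₛ′)
open import Relation.Binary.PropositionalEquality
open import Relation.Nullary using (¬_; yes; no)
open import Relation.Nullary.Decidable using (⌊_⌋; toSum)

false≢true : false ≡ true → ⊥
false≢true ()

𝟙 : Bool → ℕ
𝟙 b = if b then 1 else 0

∧≡true⇒ˡ : ∀ {a b} → a ∧ b ≡ true → a ≡ true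
∧≡true⇒ˡ {true} e = refl
∧≡true⇒ʳ : ∀ {a b} → a ∧ b ≡ true → b ≡ true
∧≡true⇒ʳ {true} e = e
∧≡false⇒ʳ : ∀ {a b} → a ∧ b ≡ false → a ≡ true → b ≡ false
∧≡false⇒ʳ {true} e refl = e
∧∧≡true⇒₂ : ∀ {a b c} → a ∧ (b ∧ c) ≡ true → b ≡ true
∧∧≡true⇒₂ {true} {true} e = refl
∧∧≡true⇒₃ : ∀ {a b c} → a ∧ (b ∧ c) ≡ true → c ≡ true
∧∧≡true⇒₃ {true} {true} e = e
∧≡false⇒ : ∀ {a b} → a ∧ b ≡ false → a ≡ false ⊎ b ≡ false
∧≡false⇒ {true} e = inj₂ e
∧≡false⇒ {false} e = inj₁ refl

isZero : ℕ → Bool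
isZero zero = true
isZero (suc _) = false

isZero⇒≡0 : ∀ {k} → isZero k ≡ true → k ≡ 0
isZero⇒≡0 {zero} _ = refl
¬isZero⇒≥1 : ∀ {k} → isZero k ≡ false → 1 ≤ k
¬isZero⇒≥1 {suc k} _ = s≤s z≤n

sum-tabulate : ∀ {k} (f : Fin k → ℕ) → sum (tabulate f) ≡ ∑ f
sum-tabulate {zero} f = refl
sum-tabulate {suc k} f = cong (f zero +_) (sum-tabulate (f ∘ suc))

sum-map-allFin : ∀ {k} (f : Fin k → ℕ) → sum (map f (allFin k)) ≡ ∑ f
sum-map-allFin {k} f = trans (cong sum (map-tabulate id f)) (sum-tabulate f)

∑-mono-≤ : ∀ {k} {f g : Fin k → ℕ} → (∀ i → f i ≤ g i) → ∑ f ≤ ∑ g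
∑-mono-≤ {zero} e = z≤n
∑-mono-≤ {suc k} e = +-mono-≤ (e zero) (∑-mono-≤ (e ∘ suc))

∑-zero : ∀ {k} (f : Fin k → ℕ) → (∀ i → f i ≡ 0) → ∑ f ≡ 0
∑-zero {zero} f e = refl
∑-zero {suc k} f e rewrite e zero = ∑-zero (f ∘ suc) (e ∘ suc)

∑-ones : ∀ k → ∑ {k} (λ _ → 1) ≡ k
∑-ones zero = refl
∑-ones (suc k) = cong suc (∑-ones k)

∑-concentrated : ∀ {k} (f : Fin k → ℕ) (a : Fin k) → (∀ i → i ≢ a → f i ≡ 0) → ∑ f ≡ f a
∑-concentrated {suc k} f zero e = trans (cong (f zero +_) (∑-zero (f ∘ suc) (λ i → e (suc i) (λ ())))) (+-identityʳ _)
∑-concentrated {suc k} f (suc a) e rewrite e zero (λ ()) =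
  ∑-concentrated (f ∘ suc) a (λ i ne → e (suc i) (λ eq → ne (Fin.suc-injective eq)))

single : ∀ {k} → Fin k → ℕ → Fin k → ℕ
single a c i = if ⌊ i ≟ a ⌋ then c else 0

single-at : ∀ {k} (a : Fin k) c → single a c a ≡ c
single-at a c with a ≟ a
... | yes _ = refl
... | no ne = ⊥-elim (ne refl)

single-off : ∀ {k} (a i : Fin k) c → i ≢ a → single a c i ≡ 0
single-off a i c ne with i ≟ a
... | yes e = ⊥-elim (ne e)
... | no _ = refl

∑-single : ∀ {k} (a : Fin k) c → ∑ (single a c) ≡ c
∑-single a c = trans (∑-concentrated (single a c) a (λ i ne → single-off a i c ne)) (single-at a c)

find : ∀ {k} (P : Fin k → Bool) → (Σ (Fin k) λ z → P z ≡ true) ⊎ (∀ z → P z ≡ false)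
find {zero} P = inj₂ (λ ())
find {suc k} P with P zero in eq
... | true = inj₁ (zero , eq)
... | false with find (P ∘ suc)
...   | inj₁ (z , e) = inj₁ (suc z , e)
...   | inj₂ h = inj₂ λ { zero → eq ; (suc z) → h z }

count : ∀ {k} → Fin k → List (Fin k) → ℕ
count x [] = 0
count x (y ∷ l) = 𝟙 ⌊ x ≟ y ⌋ + count x l

count-++ : ∀ {k} (x : Fin k) X Y → count x (X ++ Y) ≡ count x X + count x Y
count-++ x [] Y = refl
count-++ x (y ∷ X) Y rewrite count-++ x X Y = sym (+-assoc (𝟙 ⌊ x ≟ y ⌋) _ _)

record Distinct {k} (L : List (Fin k)) : Set where
  constructor distinct
  field dcount : ∀ x → count x L ≤ 1
open Distinct public

length≡∑count : ∀ {k} (L : List (Fin k)) → length L ≡ ∑ (λ x → count x L)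
length≡∑count {k} [] = sym (∑-zero {k} _ (λ _ → refl))
length≡∑count (y ∷ L) = begin
  suc (length L)                         ≡⟨ cong suc (length≡∑count L) ⟩
  1 + ∑ (λ x → count x L)                ≡⟨ cong (_+ ∑ (λ x → count x L)) (sym (∑-single y 1)) ⟩
  ∑ (single y 1) + ∑ (λ x → count x L)   ≡⟨ sym (∑-distrib-+ (single y 1) (λ x → count x L)) ⟩
  ∑ (λ x → single y 1 x + count x L)     ≡⟨ sum-cong-≗ (λ x → cong (_+ count x L) (single≡𝟙 x)) ⟩
  ∑ (λ x → count x (y ∷ L))              ∎
  where
  open ≡-Reasoning
  single≡𝟙 : ∀ x → single y 1 x ≡ 𝟙 ⌊ x ≟ y ⌋
  single≡𝟙 x with x ≟ y
  ... | yes _ = refl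
  ... | no _ = refl

distinct⇒length≤ : ∀ {k} (L : List (Fin k)) → Distinct L → length L ≤ k
distinct⇒length≤ {k} L d = subst (_≤ k) (sym (length≡∑count L))
  (subst (∑ (λ x → count x L) ≤_) (∑-ones k) (∑-mono-≤ (dcount d)))

split-at : ∀ {k} (x : Fin k) (L : List (Fin k)) → 1 ≤ count x L →
           Σ (List (Fin k)) λ A → Σ (List (Fin k)) λ B → L ≡ A ++ x ∷ B
split-at x [] ()
split-at x (y ∷ L) c with x ≟ y
... | yes refl = [] , L , refl
... | no _ with split-at x L c
...   | A , B , e = y ∷ A , B , cong (y ∷_) e

count-∷-≢ : ∀ {k} {z y : Fin k} L → z ≢ y → count z (y ∷ L) ≡ count z L
count-∷-≢ {z = z} {y} L ne with z ≟ y
... | yes e = ⊥-elim (ne e)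
... | no _ = refl

count-∷≥1 : ∀ {k} (z y : Fin k) L → 1 ≤ count z (y ∷ L) → z ≡ y ⊎ 1 ≤ count z L
count-∷≥1 z y L c with toSum (z ≟ y)
... | inj₁ e = inj₁ e
... | inj₂ ne = inj₂ (subst (1 ≤_) (count-∷-≢ L ne) c)

count-++≥1 : ∀ {k} (z : Fin k) X Y → 1 ≤ count z (X ++ Y) → 1 ≤ count z X ⊎ 1 ≤ count z Y
count-++≥1 z X Y c rewrite count-++ z X Y with count z X
... | zero = inj₂ c
... | suc k = inj₁ (s≤s z≤n)

isEven : ℕ → Bool
isEven zero = true
isEven (suc m) = not (isEven m)

isEven-pred-of-odd : ∀ t → isEven (suc t) ≡ false → isEven t ≡ true
isEven-pred-of-odd t e with isEven t | e
... | true | _ = refl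
... | false | ()

isEven-pred-of-even : ∀ t → isEven (suc t) ≡ true → isEven t ≡ false
isEven-pred-of-even t e with isEven t | e
... | false | _ = refl
... | true | ()

isEven-suc-of-even : ∀ k → isEven k ≡ true → isEven (suc k) ≡ false
isEven-suc-of-even k e rewrite e = refl

isEven-suc⇒suc : ∀ k → isEven (suc k) ≡ true → Σ ℕ λ k' → k ≡ suc k'
isEven-suc⇒suc zero ()
isEven-suc⇒suc (suc k') _ = k' , refl

xnor : Bool → Bool → Bool
xnor true b = b
xnor false b = not b

isEven-+ : ∀ a b → isEven (a + b) ≡ xnor (isEven a) (isEven b)
isEven-+ zero b = refl
isEven-+ (suc a) b rewrite isEven-+ a b with isEven a | isEven b
... | true | true = refl
... | true | false = refl
... | false | true = refl
... | false | false = refl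

isEven⇒2∣ : ∀ k → isEven k ≡ true → 2 ∣ k
isEven⇒2∣ zero _ = divides 0 refl
isEven⇒2∣ (suc zero) ()
isEven⇒2∣ (suc (suc k)) e with isEven⇒2∣ k (trans (sym (not-involutive (isEven k))) e)
... | divides q eq = divides (suc q) (cong (λ t → suc (suc t)) eq)

+-tight : ∀ {a a' b b'} → a ≤ a' → b ≤ b' → a + b ≡ a' + b' → a ≡ a' × b ≡ b'
+-tight {a} {a'} {b} {b'} la lb e = ea , +-cancelˡ-≡ a b b' (trans e (cong (_+ b') (sym ea)))
  where
  ea : a ≡ a'
  ea = ≤-antisym la (+-cancelʳ-≤ b' a' a (≤-trans (≤-reflexive (sym e)) (+-monoʳ-≤ a lb)))

+1≡suc⇒≡ : ∀ {d k} → d + 1 ≡ suc k → d ≡ k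
+1≡suc⇒≡ {d} {k} e = suc-injective (trans (+-comm 1 d) e)

+1≤⇒suc : ∀ {a s} → a + 1 ≤ s → Σ ℕ λ k → s ≡ suc k × a ≤ k
+1≤⇒suc {a} {suc s} h = s , refl , ≤-pred (subst (_≤ suc s) (+-comm a 1) h)
+1≤⇒suc {a} {zero} h with subst (_≤ 0) (+-comm a 1) h
... | ()

+1≤suc⇒≤ : ∀ {a b} → a + 1 ≤ suc b → a ≤ b
+1≤suc⇒≤ {a} {b} h = ≤-pred (subst (_≤ suc b) (+-comm a 1) h)

<-suc⇒≡⊎< : ∀ {i m} → i < suc m → i ≡ m ⊎ i < m
<-suc⇒≡⊎< {zero} {zero} _ = inj₁ refl
<-suc⇒≡⊎< {zero} {suc m} _ = inj₂ (s≤s z≤n)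
<-suc⇒≡⊎< {suc i} {zero} (s≤s ())
<-suc⇒≡⊎< {suc i} {suc m} (s≤s lt) with <-suc⇒≡⊎< {i} {m} lt
... | inj₁ e = inj₁ (cong suc e)
... | inj₂ l = inj₂ (s≤s l)

<1⇒≡0 : ∀ {i} → i < 1 → i ≡ 0
<1⇒≡0 (s≤s z≤n) = refl

<2-cases : ∀ {i} → i < 2 → i ≡ 0 ⊎ i ≡ 1
<2-cases (s≤s z≤n) = inj₁ refl
<2-cases (s≤s (s≤s z≤n)) = inj₂ refl

<3-cases : ∀ {i} → i < 3 → i ≡ 0 ⊎ i ≡ 1 ⊎ i ≡ 2
<3-cases (s≤s z≤n) = inj₁ refl
<3-cases (s≤s (s≤s z≤n)) = inj₂ (inj₁ refl)
<3-cases (s≤s (s≤s (s≤s z≤n))) = inj₂ (inj₂ refl)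

-- Δ k d = (1 + d) ^ k ∸ d ^ k, defined without truncated subtraction.
Δ : ℕ → ℕ → ℕ
Δ zero d = 0
Δ (suc k) d = d ^ k + suc d * Δ k d

^+Δ : ∀ k d → d ^ k + Δ k d ≡ suc d ^ k
^+Δ zero d = refl
^+Δ (suc k) d rewrite sym (^+Δ k d) = lem d (d ^ k) (Δ k d)
  where
  lem : ∀ d X F → d * X + (X + suc d * F) ≡ suc d * (X + F)
  lem = solve-∀

Δ-mono-≤ : ∀ k {d e} → d ≤ e → Δ k d ≤ Δ k e
Δ-mono-≤ zero le = z≤n
Δ-mono-≤ (suc k) le = +-mono-≤ (^-monoˡ-≤ k le) (*-mono-≤ (s≤s le) (Δ-mono-≤ k le))

Δ-mono-< : ∀ k {d e} → d < e → Δ (2 + k) d < Δ (2 + k) e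
Δ-mono-< k lt = +-mono-<-≤ (^-monoˡ-< (suc k) lt) (*-mono-≤ (s≤s (<⇒≤ lt)) (Δ-mono-≤ (suc k) (<⇒≤ lt)))

module Exponent (q : ℕ) where

  p : ℕ
  p = 2 + q

  -- φ m = e_p(F_m): adding vertex m + 1 to F_(m+1) raises the centre from degree m to m + 1
  -- and either adds a pendant leaf (m even) or matches the new leaf with the previous one.
  bonus : ℕ → ℕ
  bonus m = if isEven m then 1 else 2 ^ p + Δ p 1

  φ : ℕ → ℕ
  φ zero = 0
  φ (suc zero) = 0
  φ (suc (suc m)) = φ (suc m) + Δ p m + bonus m

  Δ-injective : ∀ {d k} → d ≤ k → Δ p d ≡ Δ p k → d ≡ k
  Δ-injective le e with m≤n⇒m<n∨m≡n le
  ... | inj₂ eq = eq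
  ... | inj₁ lt = ⊥-elim (<-irrefl e (Δ-mono-< q lt))

  1+Δ1≡2^p : 1 + Δ p 1 ≡ 2 ^ p
  1+Δ1≡2^p = trans (cong (_+ Δ p 1) (sym (^-zeroˡ p))) (^+Δ p 1)

  2≤2^p : 2 ≤ 2 ^ p
  2≤2^p = ^-monoʳ-≤ 2 {1} {p} (s≤s z≤n)

  1≤bonus : ∀ m → 1 ≤ bonus m
  1≤bonus m with isEven m
  ... | true = ≤-refl
  ... | false = ≤-trans (≤-trans (s≤s z≤n) 2≤2^p) (m≤m+n (2 ^ p) (Δ p 1))

  1<bonus-odd : ∀ m → isEven m ≡ false → 1 < bonus m
  1<bonus-odd m e rewrite e = ≤-trans 2≤2^p (m≤m+n (2 ^ p) (Δ p 1))

  φ-mono : ∀ m → φ m ≤ φ (suc m)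
  φ-mono zero = z≤n
  φ-mono (suc m) = ≤-trans (m≤m+n (φ (suc m)) (Δ p m)) (m≤m+n _ (bonus m))

  φ-pendant-≤ : ∀ k → φ (suc k) + 1 + Δ p k ≤ φ (suc (suc k))
  φ-pendant-≤ k = subst (_≤ φ (suc (suc k))) (lem (φ (suc k)) (Δ p k))
       (+-mono-≤ (≤-refl {φ (suc k) + Δ p k}) (1≤bonus k))
    where
    lem : ∀ a b → a + b + 1 ≡ a + 1 + b
    lem = solve-∀

  φ-pendant-< : ∀ k → isEven k ≡ false → φ (suc k) + 1 + Δ p k < φ (suc (suc k))
  φ-pendant-< k e = subst (_≤ φ (suc (suc k))) (lem (φ (suc k)) (Δ p k))
       (+-mono-≤ (≤-refl {φ (suc k) + Δ p k}) (1<bonus-odd k e))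
    where
    lem : ∀ a b → a + b + 2 ≡ suc (a + 1 + b)
    lem = solve-∀

  φ-< : ∀ k → φ (suc k) < φ (suc (suc k))
  φ-< k = ≤-trans (≤-trans (≤-reflexive (+-comm 1 (φ (suc k)))) (m≤m+n _ (Δ p k))) (φ-pendant-≤ k)

  bonus-+-bonus : ∀ k → bonus k + bonus (suc k) ≡ 2 ^ p + 2 ^ p
  bonus-+-bonus k with isEven k
  ... | true = trans (sym (+-assoc 1 (2 ^ p) (Δ p 1)))
                 (trans (cong (_+ Δ p 1) (+-comm 1 (2 ^ p)))
                 (trans (+-assoc (2 ^ p) 1 (Δ p 1)) (cong (2 ^ p +_) 1+Δ1≡2^p)))
  ... | false = trans (+-assoc (2 ^ p) (Δ p 1) 1) (cong (2 ^ p +_) (trans (+-comm (Δ p 1) 1) 1+Δ1≡2^p))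

  φ-suspended : ∀ k → φ (suc (suc (suc k))) ≡ φ (suc k) + (2 ^ p + 2 ^ p) + Δ p (suc k) + Δ p k
  φ-suspended k rewrite sym (bonus-+-bonus k) = lem (φ (suc k)) (Δ p k) (bonus k) (Δ p (suc k)) (bonus (suc k))
    where
    lem : ∀ a b c d e → a + b + c + d + e ≡ a + (c + e) + d + b
    lem = solve-∀

module _ {n : ℕ} where

  deg : Graph n → Fin n → ℕ
  deg G v = ∑ (λ w → 𝟙 (adj G v w))

  degree≡deg : (G : Graph n) (v : Fin n) → degree G v ≡ deg G v
  degree≡deg G v = sum-map-allFin (λ w → 𝟙 (adj G v w))

  powSum : ℕ → Graph n → ℕ
  powSum p G = ∑ (λ v → deg G v ^ p)

  degPow≡powSum : ∀ p (G : Graph n) → degPow p G ≡ powSum p G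
  degPow≡powSum p G = trans (sum-map-allFin (λ v → degree G v ^ p)) (sum-cong-≗ (λ v → cong (_^ p) (degree≡deg G v)))

  neqᵇ : Fin n → Fin n → Bool
  neqᵇ a v = not ⌊ a ≟ v ⌋

  neqᵇ-refl : ∀ v → neqᵇ v v ≡ false
  neqᵇ-refl v with v ≟ v
  ... | yes _ = refl
  ... | no ne = ⊥-elim (ne refl)

  ≢⇒neqᵇ : ∀ a v → a ≢ v → neqᵇ a v ≡ true
  ≢⇒neqᵇ a v ne with a ≟ v
  ... | yes e = ⊥-elim (ne e)
  ... | no _ = refl

  neqᵇ⇒≢ : ∀ {z a : Fin n} → neqᵇ z a ≡ true → z ≢ a
  neqᵇ⇒≢ {z} {a} e eq rewrite eq = false≢true (trans (sym (neqᵇ-refl a)) e)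

  ¬neqᵇ⇒≡ : ∀ {z a : Fin n} → neqᵇ z a ≡ false → z ≡ a
  ¬neqᵇ⇒≡ {z} {a} e with z ≟ a
  ... | yes eq = eq
  ... | no _ = ⊥-elim (false≢true (sym e))

  ¬neqᵇ∧neqᵇ⇒ : ∀ {z a b : Fin n} → (neqᵇ z a ∧ neqᵇ z b) ≡ false → z ≡ a ⊎ z ≡ b
  ¬neqᵇ∧neqᵇ⇒ e with ∧≡false⇒ e
  ... | inj₁ x = inj₁ (¬neqᵇ⇒≡ x)
  ... | inj₂ y = inj₂ (¬neqᵇ⇒≡ y)

  remove : Graph n → Fin n → Graph n
  remove G v = record
    { adj = λ a b → adj G a b ∧ (neqᵇ a v ∧ neqᵇ b v)
    ; sym = λ a b → cong₂ _∧_ (adj-comm G a b) (∧-comm (neqᵇ a v) (neqᵇ b v))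
    ; irrefl = λ a → cong (_∧ (neqᵇ a v ∧ neqᵇ a v)) (irrefl G a) }

  adj-sym : (G : Graph n) → ∀ {a b} → adj G a b ≡ true → adj G b a ≡ true
  adj-sym G {a} {b} e = trans (adj-comm G b a) e

  adj⇒≢ : (G : Graph n) → ∀ {a b} → adj G a b ≡ true → a ≢ b
  adj⇒≢ G {a} e refl rewrite irrefl G a = false≢true e

  remove-⊆ : (G : Graph n) (v : Fin n) → ∀ {a b} → adj (remove G v) a b ≡ true → adj G a b ≡ true
  remove-⊆ G v {a} {b} e with adj G a b
  ... | true = refl
  ... | false = e

  remove-adj : (G : Graph n) (v : Fin n) → ∀ {a b} → a ≢ v → b ≢ v → adj (remove G v) a b ≡ adj G a b
  remove-adj G v {a} {b} na nb' rewrite ≢⇒neqᵇ a v na | ≢⇒neqᵇ b v nb' = ∧-identityʳ _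

  deg-remove-self : (G : Graph n) (v : Fin n) → deg (remove G v) v ≡ 0
  deg-remove-self G v = ∑-zero _ (λ z → cong 𝟙 (trans (cong (λ t → adj G v z ∧ (t ∧ neqᵇ z v)) (neqᵇ-refl v)) (∧-zeroʳ _)))

  deg-remove : (G : Graph n) (v a : Fin n) → a ≢ v → deg G a ≡ deg (remove G v) a + 𝟙 (adj G a v)
  deg-remove G v a ne = trans (sum-cong-≗ pw) (trans (∑-distrib-+ {n} _ _) (cong (deg (remove G v) a +_) (∑-single v _)))
    where
    pw : ∀ z → 𝟙 (adj G a z) ≡ 𝟙 (adj (remove G v) a z) + single v (𝟙 (adj G a v)) z
    pw z rewrite ≢⇒neqᵇ a v ne with z ≟ v
    ... | yes refl rewrite ∧-zeroʳ (adj G a v) = refl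
    ... | no _ rewrite ∧-identityʳ (adj G a z) = sym (+-identityʳ _)

  deg≡0 : (G : Graph n) (v : Fin n) → (∀ z → adj G v z ≡ false) → deg G v ≡ 0
  deg≡0 G v h = ∑-zero _ (λ z → cong 𝟙 (h z))

  𝟙-true : ∀ {b} → b ≡ true → 𝟙 b ≡ 1
  𝟙-true refl = refl
  𝟙-false : ∀ {b} → b ≡ false → 𝟙 b ≡ 0
  𝟙-false refl = refl

  true⊎false : ∀ (b : Bool) → b ≡ true ⊎ b ≡ false
  true⊎false true = inj₁ refl
  true⊎false false = inj₂ refl

  deg≡1 : (G : Graph n) (v x : Fin n) → (∀ z → adj G v z ≡ true → z ≡ x) → adj G v x ≡ true → deg G v ≡ 1
  deg≡1 G v x h ax = trans (sum-cong-≗ pw) (∑-single x 1)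
    where
    pw : ∀ z → 𝟙 (adj G v z) ≡ single x 1 z
    pw z with z ≟ x
    ... | yes refl = 𝟙-true ax
    ... | no ne with true⊎false (adj G v z)
    ...   | inj₁ t = ⊥-elim (ne (h z t))
    ...   | inj₂ f = 𝟙-false f

  deg≡2 : (G : Graph n) (v x y : Fin n) → (∀ z → adj G v z ≡ true → z ≡ x ⊎ z ≡ y) →
         adj G v x ≡ true → adj G v y ≡ true → x ≢ y → deg G v ≡ 2
  deg≡2 G v x y h ax ay xy = trans (sum-cong-≗ pw) (trans (∑-distrib-+ {n} _ _) (cong₂ _+_ (∑-single x 1) (∑-single y 1)))
    where
    pw : ∀ z → 𝟙 (adj G v z) ≡ single x 1 z + single y 1 z
    pw z with z ≟ x | z ≟ y
    ... | yes refl | yes refl = ⊥-elim (xy refl)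
    ... | yes refl | no _ = 𝟙-true ax
    ... | no _ | yes refl = 𝟙-true ay
    ... | no nx | no ny with true⊎false (adj G v z)
    ...   | inj₁ t = ⊥-elim ([ nx , ny ]′ (h z t))
    ...   | inj₂ f = 𝟙-false f

  Supp : Graph n → (Fin n → Bool) → Set
  Supp H S = ∀ a b → adj H a b ≡ true → S a ≡ true

  size : (Fin n → Bool) → ℕ
  size S = ∑ (λ a → 𝟙 (S a))

  without : (Fin n → Bool) → Fin n → (Fin n → Bool)
  without S v a = S a ∧ neqᵇ a v

  size-without : (S : Fin n → Bool) (v : Fin n) → S v ≡ true → size S ≡ suc (size (without S v))
  size-without S v sv = trans (sum-cong-≗ pw) (trans (∑-distrib-+ {n} _ _) (trans (cong (_+ size (without S v)) (∑-single v 1)) refl))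
    where
    pw : ∀ z → 𝟙 (S z) ≡ single v 1 z + 𝟙 (without S v z)
    pw z with z ≟ v
    ... | yes refl rewrite sv = refl
    ... | no _ rewrite ∧-identityʳ (S z) = refl

  without-member : (S : Fin n → Bool) (v a : Fin n) → S a ≡ true → a ≢ v → without S v a ≡ true
  without-member S v a sa ne rewrite sa | ≢⇒neqᵇ a v ne = refl

  Supp-remove : (H : Graph n) (S : Fin n → Bool) (v : Fin n) → Supp H S → Supp (remove H v) (without S v)
  Supp-remove H S v sp a b e with adj H a b in eab | neqᵇ a v | neqᵇ b v
  ... | true | true | true = cong (_∧ true) (sp a b eab)
  ... | true | true | false = ⊥-elim (false≢true e)
  ... | true | false | _ = ⊥-elim (false≢true e)
  ... | false | _ | _ = ⊥-elim (false≢true e)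

  Supp-target : (H : Graph n) (S : Fin n → Bool) → Supp H S → ∀ a b → adj H a b ≡ true → S b ≡ true
  Supp-target H S sp a b e = sp b a (trans (adj-comm H b a) e)

  deg+1≤size : (H : Graph n) (S : Fin n → Bool) → Supp H S → ∀ x → S x ≡ true → deg H x + 1 ≤ size S
  deg+1≤size H S sp x sx = subst (_≤ size S) (trans (∑-distrib-+ {n} _ _) (cong (deg H x +_) (∑-single x 1))) (∑-mono-≤ pw)
    where
    pw : ∀ z → 𝟙 (adj H x z) + single x 1 z ≤ 𝟙 (S z)
    pw z with z ≟ x
    ... | yes refl rewrite irrefl H x | sx = ≤-refl
    ... | no _ with true⊎false (adj H x z)
    ...   | inj₁ t rewrite t | Supp-target H S sp x z t = ≤-refl
    ...   | inj₂ f rewrite f = z≤n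

  noEven-⊆ : (H G : Graph n) → (∀ a b → adj H a b ≡ true → adj G a b ≡ true) → ¬ HasEvenCycle G → ¬ HasEvenCycle H
  noEven-⊆ H G s ne (m , d , c) = ne (m , d , record
    { len≥3 = Cycle.len≥3 c ; vert = Cycle.vert c ; inj = Cycle.inj c
    ; step = λ i → s _ _ (Cycle.step c i) ; close = s _ _ (Cycle.close c) })

  noEven-remove : (G : Graph n) (v : Fin n) → ¬ HasEvenCycle G → ¬ HasEvenCycle (remove G v)
  noEven-remove G v = noEven-⊆ (remove G v) G (λ a b → remove-⊆ G v)

module PowSumRemoval (k : ℕ) {n : ℕ} where

  private
    p : ℕ
    p = suc k

  ^-+-identityʳ : ∀ d → (d + 0) ^ p ≡ d ^ p + 0
  ^-+-identityʳ d = trans (cong (_^ p) (+-identityʳ d)) (sym (+-identityʳ _))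

  powSum-remove-isolated : (G : Graph n) (v : Fin n) → (∀ z → adj G v z ≡ false) → powSum p G ≡ powSum p (remove G v)
  powSum-remove-isolated G v h = sum-cong-≗ pw
    where
    pw : ∀ a → deg G a ^ p ≡ deg (remove G v) a ^ p
    pw a with toSum (a ≟ v)
    ... | inj₁ refl = cong (_^ p) (trans (deg≡0 G v h) (sym (deg-remove-self G v)))
    ... | inj₂ ne rewrite deg-remove G v a ne | trans (adj-comm G a v) (h a) = cong (_^ p) (+-identityʳ (deg (remove G v) a))

  powSum-remove-pendant : (G : Graph n) (v x : Fin n) → (∀ z → adj G v z ≡ true → z ≡ x) → adj G v x ≡ true →
       powSum p G ≡ powSum p (remove G v) + 1 + Δ p (deg (remove G v) x)
  powSum-remove-pendant G v x h ax = trans (sum-cong-≗ pw) (trans (∑-distrib-+ {n} _ _) (trans (cong (powSum p (remove G v) +_)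
       (trans (∑-distrib-+ {n} _ _) (cong₂ _+_ (∑-single v 1) (∑-single x _)))) (sym (+-assoc _ 1 _))))
    where
    G' = remove G v
    vx : v ≢ x
    vx = adj⇒≢ G ax
    pw : ∀ a → deg G a ^ p ≡ deg G' a ^ p + (single v 1 a + single x (Δ p (deg G' x)) a)
    pw a with toSum (a ≟ v)
    ... | inj₁ refl rewrite deg≡1 G v x h ax | single-at v 1 | single-off x v (Δ p (deg G' x)) vx = trans (^-zeroˡ p) (cong (λ t → t ^ p + 1) (sym (deg-remove-self G v)))
    ... | inj₂ ne with toSum (a ≟ x)
    ...   | inj₁ refl rewrite deg-remove G v x ne | adj-sym G ax | single-off v x 1 ne | single-at x (Δ p (deg G' x)) =
              trans (cong (_^ p) (+-comm (deg G' x) 1)) (sym (^+Δ p (deg G' x)))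
    ...   | inj₂ nx rewrite deg-remove G v a ne | single-off v a 1 ne | single-off x a (Δ p (deg G' x)) nx with true⊎false {n} (adj G a v)
    ...     | inj₁ t = ⊥-elim (nx (h a (adj-sym G t)))
    ...     | inj₂ f rewrite f = ^-+-identityʳ (deg G' a)

  powSum-remove-deg2 : (G : Graph n) (v x y : Fin n) → (∀ z → adj G v z ≡ true → z ≡ x ⊎ z ≡ y) →
       adj G v x ≡ true → adj G v y ≡ true → x ≢ y →
       powSum p G ≡ powSum p (remove G v) + 2 ^ p + Δ p (deg (remove G v) x) + Δ p (deg (remove G v) y)
  powSum-remove-deg2 G v x y h ax ay xy = trans (sum-cong-≗ pw) (trans (∑-distrib-+ {n} _ _) (trans (cong (powSum p (remove G v) +_)
       (trans (∑-distrib-+ {n} _ _) (cong₂ _+_ (∑-single v _) (trans (∑-distrib-+ {n} _ _) (cong₂ _+_ (∑-single x _) (∑-single y _))))))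
       (lem (powSum p (remove G v)) (2 ^ p) (Δ p (deg (remove G v) x)) (Δ p (deg (remove G v) y)))))
    where
    lem : ∀ a b c d → a + (b + (c + d)) ≡ a + b + c + d
    lem = solve-∀
    G' = remove G v
    vx : v ≢ x
    vx = adj⇒≢ G ax
    vy : v ≢ y
    vy = adj⇒≢ G ay
    pw : ∀ a → deg G a ^ p ≡ deg G' a ^ p + (single v (2 ^ p) a + (single x (Δ p (deg G' x)) a + single y (Δ p (deg G' y)) a))
    pw a with toSum (a ≟ v)
    ... | inj₁ refl rewrite deg≡2 G v x y h ax ay xy | single-at v (2 ^ p)
          | single-off x v (Δ p (deg G' x)) vx | single-off y v (Δ p (deg G' y)) vy = trans (sym (+-identityʳ _)) (cong (λ t → t ^ p + (2 ^ p + 0)) (sym (deg-remove-self G v)))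
    ... | inj₂ ne with toSum (a ≟ x)
    ...   | inj₁ refl rewrite deg-remove G v x ne | adj-sym G ax | single-off v x (2 ^ p) ne | single-at x (Δ p (deg G' x))
               | single-off y x (Δ p (deg G' y)) xy =
              trans (cong (_^ p) (+-comm (deg G' x) 1)) (trans (sym (^+Δ p (deg G' x))) (cong (deg G' x ^ p +_) (sym (+-identityʳ _))))
    ...   | inj₂ nx with toSum (a ≟ y)
    ...     | inj₁ refl rewrite deg-remove G v y ne | adj-sym G ay | single-off v y (2 ^ p) ne | single-off x y (Δ p (deg G' x)) nx
               | single-at y (Δ p (deg G' y)) =
              trans (cong (_^ p) (+-comm (deg G' y) 1)) (sym (^+Δ p (deg G' y)))
    ...     | inj₂ ny rewrite deg-remove G v a ne | single-off v a (2 ^ p) ne | single-off x a (Δ p (deg G' x)) nx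
               | single-off y a (Δ p (deg G' y)) ny with true⊎false {n} (adj G a v)
    ...       | inj₁ t = ⊥-elim ([ nx , ny ]′ (h a (adj-sym G t)))
    ...       | inj₂ f rewrite f = ^-+-identityʳ (deg G' a)

module _ {n : ℕ} where

  count-lookup≥1 : ∀ (L : List (Fin n)) i → 1 ≤ count (lookup L i) L
  count-lookup≥1 (y ∷ L) zero with y ≟ y
  ... | yes _ = s≤s z≤n
  ... | no ne = ⊥-elim (ne refl)
  count-lookup≥1 (y ∷ L) (suc i) = ≤-trans (count-lookup≥1 L i) (m≤n+m _ _)

  distinct-tail : ∀ (y : Fin n) L → Distinct (y ∷ L) → Distinct L
  distinct-tail y L d = distinct λ x → ≤-trans (m≤n+m _ _) (dcount d x)

  distinct-head : ∀ (y : Fin n) L → Distinct (y ∷ L) → count y L ≡ 0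
  distinct-head y L d with y ≟ y | dcount d y
  ... | yes _ | s≤s le = n≤0⇒n≡0 le
  ... | no ne | _ = ⊥-elim (ne refl)

  distinct⇒lookup-injective : ∀ (L : List (Fin n)) → Distinct L → ∀ i j → lookup L i ≡ lookup L j → i ≡ j
  distinct⇒lookup-injective (y ∷ L) d zero zero e = refl
  distinct⇒lookup-injective (y ∷ L) d zero (suc j) e = ⊥-elim (case (subst (λ t → 1 ≤ count t L) (sym e) (count-lookup≥1 L j)))
    where case : 1 ≤ count y L → ⊥
          case le rewrite distinct-head y L d with le
          ... | ()
  distinct⇒lookup-injective (y ∷ L) d (suc i) zero e = ⊥-elim (case (subst (λ t → 1 ≤ count t L) e (count-lookup≥1 L i)))
    where case : 1 ≤ count y L → ⊥
          case le rewrite distinct-head y L d with le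
          ... | ()
  distinct⇒lookup-injective (y ∷ L) d (suc i) (suc j) e = cong suc (distinct⇒lookup-injective L (distinct-tail y L d) i j e)

module _ {n : ℕ} (G : Graph n) where

  Walk : Fin n → List (Fin n) → Set
  Walk a [] = ⊤
  Walk a (b ∷ l) = adj G a b ≡ true × Walk b l

  endpoint : Fin n → List (Fin n) → Fin n
  endpoint a [] = a
  endpoint a (b ∷ l) = endpoint b l

  endpoint-∷ʳ : ∀ a X y → endpoint a (X ++ y ∷ []) ≡ y
  endpoint-∷ʳ a [] y = refl
  endpoint-∷ʳ a (b ∷ X) y = endpoint-∷ʳ b X y

  endpoint-++ : ∀ a X Y → endpoint a (X ++ Y) ≡ endpoint (endpoint a X) Y
  endpoint-++ a [] Y = refl
  endpoint-++ a (b ∷ X) Y = endpoint-++ b X Y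

  walk-++⁻ : ∀ a X Y → Walk a (X ++ Y) → Walk a X × Walk (endpoint a X) Y
  walk-++⁻ a [] Y c = tt , c
  walk-++⁻ a (b ∷ X) Y (e , c) with walk-++⁻ b X Y c
  ... | c₁ , c₂ = (e , c₁) , c₂

  walk-++⁺ : ∀ a X Y → Walk a X → Walk (endpoint a X) Y → Walk a (X ++ Y)
  walk-++⁺ a [] Y _ c = c
  walk-++⁺ a (b ∷ X) Y (e , c₁) c₂ = e , walk-++⁺ b X Y c₁ c₂

  walk-∷ʳ : ∀ a X y → Walk a X → adj G (endpoint a X) y ≡ true → Walk a (X ++ y ∷ [])
  walk-∷ʳ a X y c e = walk-++⁺ a X (y ∷ []) c (e , tt)

  walk-lookup-step : ∀ a L b → Walk a (L ++ b ∷ []) → (i : Fin (length L)) →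
            adj G (lookup (a ∷ L) (inject₁ i)) (lookup L i) ≡ true
  walk-lookup-step a (y ∷ L) b (e , c) zero = e
  walk-lookup-step a (y ∷ L) b (e , c) (suc i) = walk-lookup-step y L b c i

  walk-lookup-close : ∀ a L b → Walk a (L ++ b ∷ []) → adj G (lookup (a ∷ L) (fromℕ (length L))) b ≡ true
  walk-lookup-close a [] b (e , _) = e
  walk-lookup-close a (y ∷ L) b (e , c) = walk-lookup-close y L b c

  closedWalk⇒evenCycle : ∀ a L → 2 ≤ length L → Distinct (a ∷ L) → Walk a (L ++ a ∷ []) → isEven (suc (length L)) ≡ true → HasEvenCycle G
  closedWalk⇒evenCycle a L len d c e = length L , isEven⇒2∣ _ e , record
    { len≥3 = len
    ; vert = lookup (a ∷ L)
    ; inj = λ {i} {j} eq → distinct⇒lookup-injective (a ∷ L) d i j eq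
    ; step = walk-lookup-step a L a c
    ; close = walk-lookup-close a L a c }

module _ {n : ℕ} where
  infix 4 _⊑_
  data _⊑_ : List (Fin n) → List (Fin n) → Set where
    nil  : ∀ {L} → [] ⊑ L
    keep : ∀ {x X Y} → X ⊑ Y → x ∷ X ⊑ x ∷ Y
    skip : ∀ {y X Y} → X ⊑ Y → X ⊑ y ∷ Y

  ⊑-refl : ∀ {X} → X ⊑ X
  ⊑-refl {[]} = nil
  ⊑-refl {x ∷ X} = keep ⊑-refl

  ⊑-++ : ∀ {X X' Y Y'} → X ⊑ X' → Y ⊑ Y' → X ++ Y ⊑ X' ++ Y'
  ⊑-++ {[]} {[]} nil q = q
  ⊑-++ {[]} {x ∷ X'} nil q = skip (⊑-++ {[]} {X'} nil q)
  ⊑-++ (keep p) q = keep (⊑-++ p q)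
  ⊑-++ {X} {y ∷ X'} (skip p) q = skip (⊑-++ p q)

  ⊑-skipL : ∀ Z {Y Y'} → Y ⊑ Y' → Y ⊑ Z ++ Y'
  ⊑-skipL Z q = ⊑-++ {[]} {Z} nil q

  ⊑-count : ∀ {X Y} → X ⊑ Y → ∀ x → count x X ≤ count x Y
  ⊑-count nil x = z≤n
  ⊑-count (keep {y} p) x = +-monoʳ-≤ (𝟙 ⌊ x ≟ y ⌋) (⊑-count p x)
  ⊑-count (skip p) x = ≤-trans (⊑-count p x) (m≤n+m _ _)

  distinct-⊑ : ∀ {X Y} → X ⊑ Y → Distinct Y → Distinct X
  distinct-⊑ p d = distinct λ x → ≤-trans (⊑-count p x) (dcount d x)

  distinct-resp-count : ∀ {X Y : List (Fin n)} → (∀ x → count x X ≡ count x Y) → Distinct Y → Distinct X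
  distinct-resp-count e d = distinct λ x → subst (_≤ 1) (sym (e x)) (dcount d x)

  distinct-∷ : ∀ (y : Fin n) L → count y L ≡ 0 → Distinct L → Distinct (y ∷ L)
  distinct-∷ y L c d = distinct f
    where
    f : ∀ x → count x (y ∷ L) ≤ 1
    f x with x ≟ y
    ... | yes refl rewrite c = s≤s z≤n
    ... | no _ = dcount d x

  distinct⇒≢ : ∀ X (a : Fin n) Y b Z → Distinct (X ++ a ∷ Y ++ b ∷ Z) → a ≢ b
  distinct⇒≢ X a Y b Z d refl = case (dcount d a)
    where
    le : 2 ≤ count a (X ++ a ∷ Y ++ a ∷ Z)
    le rewrite count-++ a X (a ∷ Y ++ a ∷ Z) | count-++ a Y (a ∷ Z) with a ≟ a
    ... | yes _ = ≤-trans (s≤s (s≤s z≤n)) (≤-trans (≤-reflexive (cong suc (sym (+-suc (count a Y) (count a Z))))) (≤-trans (s≤s (m≤n+m (count a Y + suc (count a Z)) (count a X)))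
                  (≤-reflexive (sym (+-suc (count a X) _)))))
    ... | no ne = ⊥-elim (ne refl)
    case : count a (X ++ a ∷ Y ++ a ∷ Z) ≤ 1 → ⊥
    case le' with ≤-trans le le'
    ... | s≤s ()

parity-nested : ∀ a b → isEven (a + suc b) ≡ true → isEven (suc (suc (a + 1))) ≡ true ⊎ isEven (suc (suc (b + 1))) ≡ true
parity-nested a b e rewrite isEven-+ a (suc b) | isEven-+ a 1 | isEven-+ b 1 with isEven a | isEven b
... | true | true = ⊥-elim (false≢true e)
... | true | false = inj₂ refl
... | false | true = inj₁ refl
... | false | false = ⊥-elim (false≢true e)

parity-beyond : ∀ a b → isEven a ≡ true → isEven (suc (suc (a + suc (b + 1)))) ≡ true ⊎ isEven (suc (suc (b + 1))) ≡ true
parity-beyond a b e rewrite isEven-+ a (suc (b + 1)) | isEven-+ b 1 | e with isEven b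
... | true = inj₁ refl
... | false = inj₂ refl

parity-chord-inside : ∀ a b → isEven (suc (a + suc b)) ≡ true → isEven (suc (suc (a + 1))) ≡ true ⊎ isEven (suc (suc (suc (b + 1)))) ≡ true
parity-chord-inside a b e rewrite isEven-+ a (suc b) | isEven-+ a 1 | isEven-+ b 1 with isEven a | isEven b
... | true | true = inj₂ refl
... | true | false = ⊥-elim (false≢true e)
... | false | true = ⊥-elim (false≢true e)
... | false | false = inj₁ refl

parity-chord-to-anchor : ∀ a → isEven (suc a) ≡ true → isEven (suc (suc (a + 1))) ≡ true
parity-chord-to-anchor a e rewrite isEven-+ a 1 with isEven a
... | true = ⊥-elim (false≢true e)
... | false = refl

parity-chord-beyond : ∀ a b → isEven a ≡ true → isEven (suc (a + suc (b + 1))) ≡ true ⊎ isEven (suc (suc (b + 2))) ≡ true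
parity-chord-beyond a b e rewrite isEven-+ a (suc (b + 1)) | isEven-+ b 1 | isEven-+ b 2 | e with isEven b
... | true = inj₂ refl
... | false = inj₁ refl

parity-detour-inside : ∀ a b → isEven (a + suc b) ≡ true → isEven (suc (suc (a + 1))) ≡ true ⊎ isEven (suc (suc (suc (suc (b + 1))))) ≡ true
parity-detour-inside a b e rewrite isEven-+ a (suc b) | isEven-+ a 1 | isEven-+ b 1 with isEven a | isEven b
... | true | true = ⊥-elim (false≢true e)
... | true | false = inj₂ refl
... | false | true = inj₁ refl
... | false | false = ⊥-elim (false≢true e)

parity-detour-beyond : ∀ a b → isEven a ≡ true → isEven (suc (suc (a + suc (b + 1)))) ≡ true ⊎ isEven (suc (suc (b + 3))) ≡ true
parity-detour-beyond a b e rewrite isEven-+ a (suc (b + 1)) | isEven-+ b 1 | isEven-+ b 3 | e with isEven b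
... | true = inj₁ refl
... | false = inj₂ refl

length≥2 : ∀ {A : Set} (y : A) (X : List A) z → 2 ≤ length (y ∷ X ++ z ∷ [])
length≥2 y X z rewrite length-++ X {z ∷ []} = s≤s (m≤n+m 1 (length X))

-- In the lemmas below v0 ∷ v1 ∷ A ++ vi ∷ B is a path read from its end v0, and v0 is also adjacent
-- to vi. Each lemma closes two cycles through the extra edges (or one, for back-edge-odd-gap); the
-- parity hypothesis makes one of them even.
module EvenCycleFree {n : ℕ} (H : Graph n) (noev : ¬ HasEvenCycle H) where

  endpoint-mid : ∀ a X b Y → endpoint H a (X ++ b ∷ Y) ≡ endpoint H b Y
  endpoint-mid a X b Y = endpoint-++ H a X (b ∷ Y)

  walk-close : ∀ a X {y c} → adj H c y ≡ true → adj H (endpoint H a (X ++ y ∷ [])) c ≡ true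
  walk-close a X {y} {c} e = subst (λ t → adj H t c ≡ true) (sym (endpoint-∷ʳ H a X y)) (adj-sym H e)

  δ : Fin n → Fin n → ℕ
  δ x y = 𝟙 ⌊ x ≟ y ⌋

  noEvenClosedWalk : ∀ a L → 2 ≤ length L → Distinct (a ∷ L) → Walk H a (L ++ a ∷ []) → isEven (suc (length L)) ≡ true → ⊥
  noEvenClosedWalk a L l d c e = noev (closedWalk⇒evenCycle H a L l d c e)

  ⊑-end : ∀ (X : List (Fin n)) y Y → X ++ y ∷ [] ⊑ X ++ y ∷ Y
  ⊑-end X y Y = ⊑-++ ⊑-refl (keep nil)

  back-edge-odd-gap : ∀ v0 v1 A vi B → Walk H v0 (v1 ∷ A ++ vi ∷ B) → Distinct (v0 ∷ v1 ∷ A ++ vi ∷ B) →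
         adj H v0 vi ≡ true → isEven (length A) ≡ false → ⊥
  back-edge-odd-gap v0 v1 A vi B (a01 , c) D a0i e with walk-++⁻ H v1 A (vi ∷ B) c
  ... | chA , (aAi , chB) = noEvenClosedWalk v0 (v1 ∷ A ++ vi ∷ []) (length≥2 v1 A vi)
         (distinct-⊑ (keep (keep (⊑-end A vi B))) D)
         (a01 , walk-∷ʳ H v1 (A ++ vi ∷ []) v0 (walk-∷ʳ H v1 A vi chA aAi) (walk-close v1 A a0i))
         par
    where
    par : isEven (suc (length (v1 ∷ A ++ vi ∷ []))) ≡ true
    par rewrite length-++ A {vi ∷ []} | isEven-+ (length A) 1 | e = refl

  back-edges-nested : ∀ v0 v1 A1 z A2 vi B → Walk H v0 (v1 ∷ A1 ++ z ∷ A2 ++ vi ∷ B) → Distinct (v0 ∷ v1 ∷ A1 ++ z ∷ A2 ++ vi ∷ B) →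
         adj H v0 vi ≡ true → adj H v0 z ≡ true → isEven (length A1 + suc (length A2)) ≡ true → ⊥
  back-edges-nested v0 v1 A1 z A2 vi B (a01 , c) D a0i a0z e with walk-++⁻ H v1 A1 (z ∷ A2 ++ vi ∷ B) c
  ... | chA1 , (a1z , c₂) with walk-++⁻ H z A2 (vi ∷ B) c₂
  ...   | chA2 , (a2i , chB) with parity-nested (length A1) (length A2) e
  ...     | inj₁ p = noEvenClosedWalk v0 (v1 ∷ A1 ++ z ∷ []) (length≥2 v1 A1 z)
              (distinct-⊑ (keep (keep (⊑-end A1 z (A2 ++ vi ∷ B)))) D)
              (a01 , walk-∷ʳ H v1 (A1 ++ z ∷ []) v0 (walk-∷ʳ H v1 A1 z chA1 a1z) (walk-close v1 A1 a0z))
              (subst (λ t → isEven (suc (suc t)) ≡ true) (sym (length-++ A1)) p)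
  ...     | inj₂ p = noEvenClosedWalk v0 (z ∷ A2 ++ vi ∷ []) (length≥2 z A2 vi)
              (distinct-⊑ (keep (skip (⊑-skipL A1 (keep (⊑-end A2 vi B))))) D)
              (a0z , walk-∷ʳ H z (A2 ++ vi ∷ []) v0 (walk-∷ʳ H z A2 vi chA2 a2i) (walk-close z A2 a0i))
              (subst (λ t → isEven (suc (suc t)) ≡ true) (sym (length-++ A2)) p)

  back-edges-beyond : ∀ v0 v1 A vi B1 z B2 → Walk H v0 (v1 ∷ A ++ vi ∷ B1 ++ z ∷ B2) → Distinct (v0 ∷ v1 ∷ A ++ vi ∷ B1 ++ z ∷ B2) →
         adj H v0 vi ≡ true → adj H v0 z ≡ true → isEven (length A) ≡ true → ⊥
  back-edges-beyond v0 v1 A vi B1 z B2 (a01 , c) D a0i a0z e with walk-++⁻ H v1 A (vi ∷ B1 ++ z ∷ B2) c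
  ... | chA , (aAi , c₂) with walk-++⁻ H vi B1 (z ∷ B2) c₂
  ...   | chB1 , (aBz , chB2) with parity-beyond (length A) (length B1) e
  ...     | inj₁ p = noEvenClosedWalk v0 (v1 ∷ A ++ vi ∷ B1 ++ z ∷ []) l4
              (distinct-⊑ (keep (keep (⊑-++ (⊑-refl {X = A}) (keep (⊑-end B1 z B2))))) D)
              (a01 , walk-∷ʳ H v1 (A ++ vi ∷ B1 ++ z ∷ []) v0
                 (walk-++⁺ H v1 A (vi ∷ B1 ++ z ∷ []) chA (aAi , walk-∷ʳ H vi B1 z chB1 aBz))
                 (subst (λ t → adj H t v0 ≡ true) (sym (trans (endpoint-mid v1 A vi (B1 ++ z ∷ [])) (endpoint-∷ʳ H vi B1 z))) (adj-sym H a0z)))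
              p4
    where
    l4 : 2 ≤ length (v1 ∷ A ++ vi ∷ B1 ++ z ∷ [])
    l4 rewrite length-++ A {vi ∷ B1 ++ z ∷ []} = s≤s (≤-trans (s≤s z≤n) (m≤n+m _ (length A)))
    p4 : isEven (suc (length (v1 ∷ A ++ vi ∷ B1 ++ z ∷ []))) ≡ true
    p4 rewrite length-++ A {vi ∷ B1 ++ z ∷ []} | length-++ B1 {z ∷ []} = p
  ...     | inj₂ p = noEvenClosedWalk v0 (vi ∷ B1 ++ z ∷ []) (length≥2 vi B1 z)
              (distinct-⊑ (keep (skip (⊑-skipL A (keep (⊑-end B1 z B2))))) D)
              (a0i , walk-∷ʳ H vi (B1 ++ z ∷ []) v0 (walk-∷ʳ H vi B1 z chB1 aBz) (walk-close vi B1 a0z))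
              (subst (λ t → isEven (suc (suc t)) ≡ true) (sym (length-++ B1)) p)

  chord-inside : ∀ v0 v1 a A1 w A2 vi B → Walk H v0 (v1 ∷ a ∷ A1 ++ w ∷ A2 ++ vi ∷ B) → Distinct (v0 ∷ v1 ∷ a ∷ A1 ++ w ∷ A2 ++ vi ∷ B) →
         adj H v0 vi ≡ true → adj H v1 w ≡ true → isEven (suc (length A1 + suc (length A2))) ≡ true → ⊥
  chord-inside v0 v1 a A1 w A2 vi B (a01 , a1a , c) D a0i a1w e with walk-++⁻ H a A1 (w ∷ A2 ++ vi ∷ B) c
  ... | chA1 , (aA1w , c₂) with walk-++⁻ H w A2 (vi ∷ B) c₂
  ...   | chA2 , (aA2i , chB) with parity-chord-inside (length A1) (length A2) e
  ...     | inj₁ p = noEvenClosedWalk v1 (a ∷ A1 ++ w ∷ []) (length≥2 a A1 w)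
              (distinct-⊑ (skip (keep (keep (⊑-end A1 w (A2 ++ vi ∷ B))))) D)
              (a1a , walk-∷ʳ H a (A1 ++ w ∷ []) v1 (walk-∷ʳ H a A1 w chA1 aA1w) (walk-close a A1 a1w))
              (subst (λ t → isEven (suc (suc t)) ≡ true) (sym (length-++ A1)) p)
  ...     | inj₂ p = noEvenClosedWalk v0 (v1 ∷ w ∷ A2 ++ vi ∷ []) (s≤s (s≤s z≤n))
              (distinct-⊑ (keep (keep (skip (⊑-skipL A1 (keep (⊑-end A2 vi B)))))) D)
              (a01 , a1w , walk-∷ʳ H w (A2 ++ vi ∷ []) v0 (walk-∷ʳ H w A2 vi chA2 aA2i) (walk-close w A2 a0i))
              (subst (λ t → isEven (suc (suc (suc t))) ≡ true) (sym (length-++ A2)) p)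

  chord-to-anchor : ∀ v0 v1 a A vi B → Walk H v0 (v1 ∷ a ∷ A ++ vi ∷ B) → Distinct (v0 ∷ v1 ∷ a ∷ A ++ vi ∷ B) →
         adj H v1 vi ≡ true → isEven (suc (length A)) ≡ true → ⊥
  chord-to-anchor v0 v1 a A vi B (a01 , a1a , c) D a1i e with walk-++⁻ H a A (vi ∷ B) c
  ... | chA , (aAi , chB) = noEvenClosedWalk v1 (a ∷ A ++ vi ∷ []) (length≥2 a A vi)
              (distinct-⊑ (skip (keep (keep (⊑-end A vi B)))) D)
              (a1a , walk-∷ʳ H a (A ++ vi ∷ []) v1 (walk-∷ʳ H a A vi chA aAi) (walk-close a A a1i))
              (subst (λ t → isEven (suc (suc t)) ≡ true) (sym (length-++ A)) (parity-chord-to-anchor (length A) e))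

  chord-beyond : ∀ v0 v1 A vi B1 w B2 → Walk H v0 (v1 ∷ A ++ vi ∷ B1 ++ w ∷ B2) → Distinct (v0 ∷ v1 ∷ A ++ vi ∷ B1 ++ w ∷ B2) →
         adj H v0 vi ≡ true → adj H v1 w ≡ true → isEven (length A) ≡ true → ⊥
  chord-beyond v0 v1 A vi B1 w B2 (a01 , c) D a0i a1w e with walk-++⁻ H v1 A (vi ∷ B1 ++ w ∷ B2) c
  ... | chA , (aAi , c₂) with walk-++⁻ H vi B1 (w ∷ B2) c₂
  ...   | chB1 , (aBw , chB2) with parity-chord-beyond (length A) (length B1) e
  ...     | inj₁ p = noEvenClosedWalk v1 (A ++ vi ∷ B1 ++ w ∷ []) l9
              (distinct-⊑ (skip (keep (⊑-++ (⊑-refl {X = A}) (keep (⊑-end B1 w B2))))) D)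
              (walk-∷ʳ H v1 (A ++ vi ∷ B1 ++ w ∷ []) v1
                 (walk-++⁺ H v1 A (vi ∷ B1 ++ w ∷ []) chA (aAi , walk-∷ʳ H vi B1 w chB1 aBw))
                 (subst (λ t → adj H t v1 ≡ true) (sym (trans (endpoint-mid v1 A vi (B1 ++ w ∷ [])) (endpoint-∷ʳ H vi B1 w))) (adj-sym H a1w)))
              p9
    where
    l9 : 2 ≤ length (A ++ vi ∷ B1 ++ w ∷ [])
    l9 rewrite length-++ A {vi ∷ B1 ++ w ∷ []} | length-++ B1 {w ∷ []} = ≤-trans (s≤s (m≤n+m 1 (length B1))) (m≤n+m _ (length A))
    p9 : isEven (suc (length (A ++ vi ∷ B1 ++ w ∷ []))) ≡ true
    p9 rewrite length-++ A {vi ∷ B1 ++ w ∷ []} | length-++ B1 {w ∷ []} = p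
  ...     | inj₂ p = noEvenClosedWalk v0 (vi ∷ B1 ++ w ∷ v1 ∷ []) l10
              (distinct-resp-count ceq (distinct-⊑ (keep (keep (⊑-skipL A (keep (⊑-end B1 w B2))))) D))
              (a0i , subst (Walk H vi) (sym (++-assoc B1 (w ∷ v1 ∷ []) (v0 ∷ []))) (walk-++⁺ H vi B1 (w ∷ v1 ∷ v0 ∷ []) chB1 (aBw , adj-sym H a1w , adj-sym H a01 , tt)))
              p10
    where
    l10 : 2 ≤ length (vi ∷ B1 ++ w ∷ v1 ∷ [])
    l10 rewrite length-++ B1 {w ∷ v1 ∷ []} = s≤s (≤-trans (s≤s z≤n) (m≤n+m 2 (length B1)))
    p10 : isEven (suc (length (vi ∷ B1 ++ w ∷ v1 ∷ []))) ≡ true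
    p10 rewrite length-++ B1 {w ∷ v1 ∷ []} = p
    lem : ∀ a b c d e → a + (b + (c + (d + (e + 0)))) ≡ a + (e + (b + (c + (d + 0))))
    lem = solve-∀
    ceq : ∀ x → count x (v0 ∷ vi ∷ B1 ++ w ∷ v1 ∷ []) ≡ count x (v0 ∷ v1 ∷ vi ∷ B1 ++ w ∷ [])
    ceq x rewrite count-++ x B1 (w ∷ v1 ∷ []) | count-++ x B1 (w ∷ []) = lem (δ x v0) (δ x vi) (count x B1) (δ x w) (δ x v1)

  +-rotate₃ : ∀ a b c d → a + (b + (c + d)) ≡ c + (a + (b + d))
  +-rotate₃ = solve-∀

  detour-inside : ∀ v0 v1 A1 z A2 vi B w → Walk H v0 (v1 ∷ A1 ++ z ∷ A2 ++ vi ∷ B) → Distinct (v0 ∷ v1 ∷ A1 ++ z ∷ A2 ++ vi ∷ B) →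
         count w (v0 ∷ v1 ∷ A1 ++ z ∷ A2 ++ vi ∷ B) ≡ 0 →
         adj H v0 vi ≡ true → adj H v1 w ≡ true → adj H w z ≡ true → isEven (length A1 + suc (length A2)) ≡ true → ⊥
  detour-inside v0 v1 A1 z A2 vi B w (a01 , c) D cw a0i a1w awz e with walk-++⁻ H v1 A1 (z ∷ A2 ++ vi ∷ B) c
  ... | chA1 , (a1z , c₂) with walk-++⁻ H z A2 (vi ∷ B) c₂
  ...   | chA2 , (a2i , chB) with parity-detour-inside (length A1) (length A2) e
  ...     | inj₁ p = noEvenClosedWalk w (v1 ∷ A1 ++ z ∷ []) (length≥2 v1 A1 z)
              (distinct-⊑ (keep (skip (keep (⊑-end A1 z (A2 ++ vi ∷ B))))) DW)
              (adj-sym H a1w , walk-∷ʳ H v1 (A1 ++ z ∷ []) w (walk-∷ʳ H v1 A1 z chA1 a1z) (walk-close v1 A1 awz))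
              (subst (λ t → isEven (suc (suc t)) ≡ true) (sym (length-++ A1)) p)
    where DW = distinct-∷ w _ cw D
  ...     | inj₂ p = noEvenClosedWalk v0 (v1 ∷ w ∷ z ∷ A2 ++ vi ∷ []) (s≤s (s≤s z≤n))
              (distinct-resp-count (λ x → +-rotate₃ (δ x v0) (δ x v1) (δ x w) (count x (z ∷ A2 ++ vi ∷ []))) (distinct-⊑ (keep (keep (keep (⊑-skipL A1 (keep (⊑-end A2 vi B)))))) DW))
              (a01 , a1w , awz , walk-∷ʳ H z (A2 ++ vi ∷ []) v0 (walk-∷ʳ H z A2 vi chA2 a2i) (walk-close z A2 a0i))
              (subst (λ t → isEven (suc (suc (suc (suc t)))) ≡ true) (sym (length-++ A2)) p)
    where DW = distinct-∷ w _ cw D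

  detour-to-anchor : ∀ v0 v1 A vi B w → Walk H v0 (v1 ∷ A ++ vi ∷ B) → Distinct (v0 ∷ v1 ∷ A ++ vi ∷ B) →
         count w (v0 ∷ v1 ∷ A ++ vi ∷ B) ≡ 0 →
         adj H v0 vi ≡ true → adj H v1 w ≡ true → adj H w vi ≡ true → ⊥
  detour-to-anchor v0 v1 A vi B w (a01 , c) D cw a0i a1w awi =
    noEvenClosedWalk v0 (v1 ∷ w ∷ vi ∷ []) (s≤s (s≤s z≤n))
      (distinct-resp-count (λ x → +-rotate₃ (δ x v0) (δ x v1) (δ x w) (count x (vi ∷ []))) (distinct-⊑ (keep (keep (keep (⊑-skipL A (keep nil))))) (distinct-∷ w _ cw D)))
      (a01 , a1w , awi , adj-sym H a0i , tt) refl

  detour-beyond : ∀ v0 v1 A vi B1 z B2 w → Walk H v0 (v1 ∷ A ++ vi ∷ B1 ++ z ∷ B2) → Distinct (v0 ∷ v1 ∷ A ++ vi ∷ B1 ++ z ∷ B2) →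
         count w (v0 ∷ v1 ∷ A ++ vi ∷ B1 ++ z ∷ B2) ≡ 0 →
         adj H v0 vi ≡ true → adj H v1 w ≡ true → adj H w z ≡ true → isEven (length A) ≡ true → ⊥
  detour-beyond v0 v1 A vi B1 z B2 w (a01 , c) D cw a0i a1w awz e with walk-++⁻ H v1 A (vi ∷ B1 ++ z ∷ B2) c
  ... | chA , (aAi , c₂) with walk-++⁻ H vi B1 (z ∷ B2) c₂
  ...   | chB1 , (aBz , chB2) with parity-detour-beyond (length A) (length B1) e
  ...     | inj₁ p = noEvenClosedWalk w (v1 ∷ A ++ vi ∷ B1 ++ z ∷ []) l4
              (distinct-⊑ (keep (skip (keep (⊑-++ (⊑-refl {X = A}) (keep (⊑-end B1 z B2)))))) (distinct-∷ w _ cw D))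
              (adj-sym H a1w , walk-∷ʳ H v1 (A ++ vi ∷ B1 ++ z ∷ []) w
                 (walk-++⁺ H v1 A (vi ∷ B1 ++ z ∷ []) chA (aAi , walk-∷ʳ H vi B1 z chB1 aBz))
                 (subst (λ t → adj H t w ≡ true) (sym (trans (endpoint-mid v1 A vi (B1 ++ z ∷ [])) (endpoint-∷ʳ H vi B1 z))) (adj-sym H awz)))
              p4
    where
    l4 : 2 ≤ length (v1 ∷ A ++ vi ∷ B1 ++ z ∷ [])
    l4 rewrite length-++ A {vi ∷ B1 ++ z ∷ []} = s≤s (≤-trans (s≤s z≤n) (m≤n+m _ (length A)))
    p4 : isEven (suc (length (v1 ∷ A ++ vi ∷ B1 ++ z ∷ []))) ≡ true
    p4 rewrite length-++ A {vi ∷ B1 ++ z ∷ []} | length-++ B1 {z ∷ []} = p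
  ...     | inj₂ p = noEvenClosedWalk v0 (vi ∷ B1 ++ z ∷ w ∷ v1 ∷ []) l16
              (distinct-resp-count ceq (distinct-⊑ (keep (keep (keep (⊑-skipL A (keep (⊑-end B1 z B2)))))) (distinct-∷ w _ cw D)))
              (a0i , subst (Walk H vi) (sym (++-assoc B1 (z ∷ w ∷ v1 ∷ []) (v0 ∷ []))) (walk-++⁺ H vi B1 (z ∷ w ∷ v1 ∷ v0 ∷ []) chB1 (aBz , adj-sym H awz , adj-sym H a1w , adj-sym H a01 , tt)))
              p16
    where
    l16 : 2 ≤ length (vi ∷ B1 ++ z ∷ w ∷ v1 ∷ [])
    l16 rewrite length-++ B1 {z ∷ w ∷ v1 ∷ []} = s≤s (≤-trans (s≤s z≤n) (m≤n+m 3 (length B1)))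
    p16 : isEven (suc (length (vi ∷ B1 ++ z ∷ w ∷ v1 ∷ []))) ≡ true
    p16 rewrite length-++ B1 {z ∷ w ∷ v1 ∷ []} = p
    lem : ∀ a b c d e f → a + (b + (c + (d + (e + (f + 0))))) ≡ e + (a + (f + (b + (c + (d + 0)))))
    lem = solve-∀
    ceq : ∀ x → count x (v0 ∷ vi ∷ B1 ++ z ∷ w ∷ v1 ∷ []) ≡ count x (w ∷ v0 ∷ v1 ∷ vi ∷ B1 ++ z ∷ [])
    ceq x rewrite count-++ x B1 (z ∷ w ∷ v1 ∷ []) | count-++ x B1 (z ∷ []) = lem (δ x v0) (δ x vi) (count x B1) (δ x z) (δ x w) (δ x v1)

-- Grow a path from its free end v0 while v0 has a neighbour off the path. When stuck, either the end
-- gives a configuration, or a neighbour w of v1 off the path reroutes it into a strictly longer path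
-- w ∷ v1 ∷ …; any other chord would close an even cycle. Path length is bounded by n.
module Configurations {n : ℕ} (H : Graph n) (S : Fin n → Bool) (sp : Supp H S) (noev : ¬ HasEvenCycle H) where
  open EvenCycleFree H noev

  data Configuration : Set where
    isolated : (v : Fin n) → S v ≡ true → (∀ z → adj H v z ≡ false) → Configuration
    pendant : (v x : Fin n) → (∀ z → adj H v z ≡ true → z ≡ x) → adj H v x ≡ true → Configuration
    -- x = y (a triangle) is allowed.
    suspended : (u w x y : Fin n) → (∀ z → adj H u z ≡ true → z ≡ w ⊎ z ≡ x) → adj H u w ≡ true → adj H u x ≡ true → w ≢ x →
         (∀ z → adj H w z ≡ true → z ≡ u ⊎ z ≡ y) → adj H w y ≡ true → u ≢ y → Configuration

  record Path : Set where
    constructor path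
    field
      v0 : Fin n
      R : List (Fin n)
      pch : Walk H v0 R
      pds : Distinct (v0 ∷ R)
      psv : S v0 ≡ true
  open Path

  Progress : ℕ → Set
  Progress k = Configuration ⊎ Σ Path (λ P' → k < length (R P'))

  extend-at-neighbour : ∀ v0 v1 A vi B w → Walk H v0 (v1 ∷ A ++ vi ∷ B) → Distinct (v0 ∷ v1 ∷ A ++ vi ∷ B) →
          count w (v0 ∷ v1 ∷ A ++ vi ∷ B) ≡ 0 → adj H v1 w ≡ true → adj H v0 vi ≡ true → isEven (length A) ≡ true →
          Progress (length (v1 ∷ A ++ vi ∷ B))
  extend-at-neighbour v0 v1 A vi B w ch D cw a1w a0i eA with find (λ z → adj H w z ∧ isZero (count z (w ∷ v1 ∷ A ++ vi ∷ B)))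
  ... | inj₁ (z , e) = inj₂ (path z (w ∷ v1 ∷ A ++ vi ∷ B) (adj-sym H (∧≡true⇒ˡ e) , adj-sym H a1w , proj₂ ch)
          (distinct-∷ z _ (isZero⇒≡0 (∧≡true⇒ʳ e)) (distinct-∷ w _ cw' (distinct-tail v0 _ D))) (sp z w (adj-sym H (∧≡true⇒ˡ e))) , ≤-refl)
    where cw' : count w (v1 ∷ A ++ vi ∷ B) ≡ 0
          cw' = m+n≡0⇒n≡0 (δ w v0) cw
  ... | inj₂ noneQ with find (λ z → adj H w z ∧ neqᵇ z v1)
  ...   | inj₂ none = inj₁ (pendant w v1 (λ z a → ¬neqᵇ⇒≡ (∧≡false⇒ʳ (none z) a)) (adj-sym H a1w))
  ...   | inj₁ (z , e) with count-∷≥1 z w (v1 ∷ A ++ vi ∷ B) (¬isZero⇒≥1 (∧≡false⇒ʳ (noneQ z) (∧≡true⇒ˡ e)))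
  ...     | inj₁ zw = ⊥-elim (adj⇒≢ H (∧≡true⇒ˡ e) (sym zw))
  ...     | inj₂ c with count-∷≥1 z v1 (A ++ vi ∷ B) c
  ...       | inj₁ zv1 = ⊥-elim (neqᵇ⇒≢ (∧≡true⇒ʳ e) zv1)
  ...       | inj₂ c' with count-++≥1 z A (vi ∷ B) c'
  ...         | inj₁ cA with split-at z A cA
  ...           | A1 , A2 , refl = ⊥-elim (detour-inside v0 v1 A1 z A2 vi B w
                    (subst (λ t → Walk H v0 (v1 ∷ t)) (++-assoc A1 (z ∷ A2) (vi ∷ B)) ch)
                    (subst (λ t → Distinct (v0 ∷ v1 ∷ t)) (++-assoc A1 (z ∷ A2) (vi ∷ B)) D)
                    (subst (λ t → count w (v0 ∷ v1 ∷ t) ≡ 0) (++-assoc A1 (z ∷ A2) (vi ∷ B)) cw)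
                    a0i a1w (∧≡true⇒ˡ e) (subst (λ t → isEven t ≡ true) (length-++ A1) eA))
  extend-at-neighbour v0 v1 A vi B w ch D cw a1w a0i eA | inj₂ noneQ | inj₁ (z , e) | inj₂ c | inj₂ c' | inj₂ cB with count-∷≥1 z vi B cB
  ...           | inj₁ refl = ⊥-elim (detour-to-anchor v0 v1 A z B w ch D cw a0i a1w (∧≡true⇒ˡ e))
  ...           | inj₂ cB' with split-at z B cB'
  ...             | B1 , B2 , refl = ⊥-elim (detour-beyond v0 v1 A vi B1 z B2 w ch D cw a0i a1w (∧≡true⇒ˡ e) eA)

  neqᵇ₂⇒≢ˡ : ∀ (u w a b : Fin n) → adj H u w ∧ (neqᵇ w a ∧ neqᵇ w b) ≡ true → w ≢ a
  neqᵇ₂⇒≢ˡ u w a b e = neqᵇ⇒≢ (∧∧≡true⇒₂ {adj H u w} {neqᵇ w a} {neqᵇ w b} e)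
  neqᵇ₂⇒≢ʳ : ∀ (u w a b : Fin n) → adj H u w ∧ (neqᵇ w a ∧ neqᵇ w b) ≡ true → w ≢ b
  neqᵇ₂⇒≢ʳ u w a b e = neqᵇ⇒≢ (∧∧≡true⇒₃ {adj H u w} {neqᵇ w a} {neqᵇ w b} e)

  only-two-neighbours : ∀ {u a b} → (∀ z → adj H u z ∧ (neqᵇ z a ∧ neqᵇ z b) ≡ false) → ∀ z → adj H u z ≡ true → z ≡ a ⊎ z ≡ b
  only-two-neighbours none z t = ¬neqᵇ∧neqᵇ⇒ (∧≡false⇒ʳ (none z) t)

  end-of-degree-two : ∀ v0 v1 A vi B → Walk H v0 (v1 ∷ A ++ vi ∷ B) → Distinct (v0 ∷ v1 ∷ A ++ vi ∷ B) →
          (∀ z → adj H v0 z ≡ true → z ≡ v1 ⊎ z ≡ vi) → adj H v0 vi ≡ true → isEven (length A) ≡ true →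
          Progress (length (v1 ∷ A ++ vi ∷ B))
  end-of-degree-two v0 v1 [] vi B ch D h0 a0i eA with find (λ w → adj H v1 w ∧ (neqᵇ w v0 ∧ neqᵇ w vi))
  ... | inj₂ none = inj₁ (suspended v0 v1 vi vi h0 (proj₁ ch) a0i (distinct⇒≢ (v0 ∷ []) v1 [] vi B D) (only-two-neighbours none) (proj₁ (proj₂ ch))
                          (distinct⇒≢ [] v0 (v1 ∷ []) vi B D))
  ... | inj₁ (w , e) with isZero (count w (v0 ∷ v1 ∷ vi ∷ B)) in ez
  ...   | true = extend-at-neighbour v0 v1 [] vi B w ch D (isZero⇒≡0 ez) (∧≡true⇒ˡ e) a0i eA
  ...   | false with count-∷≥1 w v0 (v1 ∷ vi ∷ B) (¬isZero⇒≥1 ez)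
  ...     | inj₁ wv0 = ⊥-elim (neqᵇ₂⇒≢ˡ v1 w v0 vi e wv0)
  ...     | inj₂ c with count-∷≥1 w v1 (vi ∷ B) c
  ...       | inj₁ wv1 = ⊥-elim (adj⇒≢ H (∧≡true⇒ˡ e) (sym wv1))
  ...       | inj₂ c' with count-∷≥1 w vi B c'
  ...         | inj₁ wvi = ⊥-elim (neqᵇ₂⇒≢ʳ v1 w v0 vi e wvi)
  ...         | inj₂ cB with split-at w B cB
  ...           | B1 , B2 , refl = ⊥-elim (chord-beyond v0 v1 [] vi B1 w B2 ch D a0i (∧≡true⇒ˡ e) eA)
  end-of-degree-two v0 v1 (a ∷ A) vi B ch D h0 a0i eA with find (λ w → adj H v1 w ∧ (neqᵇ w v0 ∧ neqᵇ w a))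
  ... | inj₂ none = inj₁ (suspended v0 v1 vi a h0 (proj₁ ch) a0i (distinct⇒≢ (v0 ∷ []) v1 (a ∷ A) vi B D) (only-two-neighbours none) (proj₁ (proj₂ ch))
                          (distinct⇒≢ [] v0 (v1 ∷ []) a (A ++ vi ∷ B) D))
  ... | inj₁ (w , e) with isZero (count w (v0 ∷ v1 ∷ a ∷ A ++ vi ∷ B)) in ez
  ...   | true = extend-at-neighbour v0 v1 (a ∷ A) vi B w ch D (isZero⇒≡0 ez) (∧≡true⇒ˡ e) a0i eA
  ...   | false with count-∷≥1 w v0 (v1 ∷ a ∷ A ++ vi ∷ B) (¬isZero⇒≥1 ez)
  ...     | inj₁ wv0 = ⊥-elim (neqᵇ₂⇒≢ˡ v1 w v0 a e wv0)
  ...     | inj₂ c with count-∷≥1 w v1 (a ∷ A ++ vi ∷ B) c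
  ...       | inj₁ wv1 = ⊥-elim (adj⇒≢ H (∧≡true⇒ˡ e) (sym wv1))
  ...       | inj₂ c' with count-∷≥1 w a (A ++ vi ∷ B) c'
  ...         | inj₁ wa = ⊥-elim (neqᵇ₂⇒≢ʳ v1 w v0 a e wa)
  ...         | inj₂ c'' with count-++≥1 w A (vi ∷ B) c''
  ...           | inj₁ cA with split-at w A cA
  ...             | A1 , A2 , refl = ⊥-elim (chord-inside v0 v1 a A1 w A2 vi B
                    (subst (λ t → Walk H v0 (v1 ∷ a ∷ t)) (++-assoc A1 (w ∷ A2) (vi ∷ B)) ch)
                    (subst (λ t → Distinct (v0 ∷ v1 ∷ a ∷ t)) (++-assoc A1 (w ∷ A2) (vi ∷ B)) D)
                    a0i (∧≡true⇒ˡ e) (subst (λ t → isEven (suc t) ≡ true) (length-++ A1) eA))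
  end-of-degree-two v0 v1 (a ∷ A) vi B ch D h0 a0i eA | inj₁ (w , e) | false | inj₂ c | inj₂ c' | inj₂ c'' | inj₂ cvB with count-∷≥1 w vi B cvB
  ...             | inj₁ refl = ⊥-elim (chord-to-anchor v0 v1 a A w B ch D (∧≡true⇒ˡ e) eA)
  ...             | inj₂ cB with split-at w B cB
  ...               | B1 , B2 , refl = ⊥-elim (chord-beyond v0 v1 (a ∷ A) vi B1 w B2 ch D a0i (∧≡true⇒ˡ e) eA)

  end-with-back-edge : ∀ v0 v1 A vi B → Walk H v0 (v1 ∷ A ++ vi ∷ B) → Distinct (v0 ∷ v1 ∷ A ++ vi ∷ B) →
          (∀ z → adj H v0 z ≡ true → 1 ≤ count z (v0 ∷ v1 ∷ A ++ vi ∷ B)) → adj H v0 vi ≡ true →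
          Progress (length (v1 ∷ A ++ vi ∷ B))
  end-with-back-edge v0 v1 A vi B ch D on a0i with isEven (length A) in eA
  ... | false = ⊥-elim (back-edge-odd-gap v0 v1 A vi B ch D a0i eA)
  ... | true with find (λ z → adj H v0 z ∧ (neqᵇ z v1 ∧ neqᵇ z vi))
  ...   | inj₂ none = end-of-degree-two v0 v1 A vi B ch D (only-two-neighbours none) a0i eA
  ...   | inj₁ (z , e) with count-∷≥1 z v0 (v1 ∷ A ++ vi ∷ B) (on z (∧≡true⇒ˡ e))
  ...     | inj₁ zv0 = ⊥-elim (adj⇒≢ H (∧≡true⇒ˡ e) (sym zv0))
  ...     | inj₂ c with count-∷≥1 z v1 (A ++ vi ∷ B) c
  ...       | inj₁ zv1 = ⊥-elim (neqᵇ₂⇒≢ˡ v0 z v1 vi e zv1)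
  ...       | inj₂ c' with count-++≥1 z A (vi ∷ B) c'
  ...         | inj₁ cA with split-at z A cA
  ...           | A1 , A2 , refl = ⊥-elim (back-edges-nested v0 v1 A1 z A2 vi B
                    (subst (λ t → Walk H v0 (v1 ∷ t)) (++-assoc A1 (z ∷ A2) (vi ∷ B)) ch)
                    (subst (λ t → Distinct (v0 ∷ v1 ∷ t)) (++-assoc A1 (z ∷ A2) (vi ∷ B)) D)
                    a0i (∧≡true⇒ˡ e) (subst (λ t → isEven t ≡ true) (length-++ A1) eA))
  end-with-back-edge v0 v1 A vi B ch D on a0i | true | inj₁ (z , e) | inj₂ c | inj₂ c' | inj₂ cvB with count-∷≥1 z vi B cvB
  ...           | inj₁ zvi = ⊥-elim (neqᵇ₂⇒≢ʳ v0 z v1 vi e zvi)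
  ...           | inj₂ cB with split-at z B cB
  ...             | B1 , B2 , refl = ⊥-elim (back-edges-beyond v0 v1 A vi B1 z B2 ch D a0i (∧≡true⇒ˡ e) eA)

  closed-end : ∀ v0 R → Walk H v0 R → Distinct (v0 ∷ R) → S v0 ≡ true →
          (∀ z → adj H v0 z ≡ true → 1 ≤ count z (v0 ∷ R)) → Progress (length R)
  closed-end v0 [] ch D sv on = inj₁ (isolated v0 sv f)
    where
    f : ∀ z → adj H v0 z ≡ false
    f z with true⊎false {n} (adj H v0 z)
    ... | inj₂ x = x
    ... | inj₁ t with count-∷≥1 z v0 [] (on z t)
    ...   | inj₁ e = ⊥-elim (adj⇒≢ H t (sym e))
    ...   | inj₂ ()
  closed-end v0 (v1 ∷ R) ch D sv on with find (λ z → adj H v0 z ∧ neqᵇ z v1)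
  ... | inj₂ none = inj₁ (pendant v0 v1 (λ z a → ¬neqᵇ⇒≡ (∧≡false⇒ʳ (none z) a)) (proj₁ ch))
  ... | inj₁ (z , e) with count-∷≥1 z v0 (v1 ∷ R) (on z (∧≡true⇒ˡ e))
  ...   | inj₁ zv0 = ⊥-elim (adj⇒≢ H (∧≡true⇒ˡ e) (sym zv0))
  ...   | inj₂ c with count-∷≥1 z v1 R c
  ...     | inj₁ zv1 = ⊥-elim (neqᵇ⇒≢ (∧≡true⇒ʳ e) zv1)
  ...     | inj₂ c' with split-at z R c'
  ...       | A , B , refl = end-with-back-edge v0 v1 A z B ch D on (∧≡true⇒ˡ e)

  extend : (P : Path) → Progress (length (R P))
  extend (path v0 R ch D sv) with find (λ z → adj H v0 z ∧ isZero (count z (v0 ∷ R)))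
  ... | inj₁ (z , e) = inj₂ (path z (v0 ∷ R) (adj-sym H (∧≡true⇒ˡ e) , ch) (distinct-∷ z (v0 ∷ R) (isZero⇒≡0 (∧≡true⇒ʳ e)) D) (sp z v0 (adj-sym H (∧≡true⇒ˡ e))) , ≤-refl)
  ... | inj₂ none = closed-end v0 R ch D sv (λ z a → ¬isZero⇒≥1 (∧≡false⇒ʳ (none z) a))

  iterate : ∀ fuel (P : Path) → n ≤ length (R P) + fuel → Configuration
  iterate zero P h = ⊥-elim (<-irrefl refl (≤-trans (distinct⇒length≤ (v0 P ∷ R P) (pds P)) (subst (n ≤_) (+-identityʳ _) h)))
  iterate (suc f) P h with extend P
  ... | inj₁ c = c
  ... | inj₂ (P' , lt) = iterate f P' (≤-trans h (subst (_≤ length (R P') + f) (sym (+-suc (length (R P)) f)) (+-monoˡ-≤ f lt)))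

  configuration : ∀ v → S v ≡ true → Configuration
  configuration v sv = iterate n (path v [] tt (distinct-∷ v [] refl (distinct (λ x → z≤n))) sv) ≤-refl

module UpperBound (q : ℕ) {n : ℕ} where
  open Exponent q
  open PowSumRemoval (suc q) {n}

  pendant-after-remove : ∀ (H : Graph n) u w y → (∀ z → adj H w z ≡ true → z ≡ u ⊎ z ≡ y) → u ≢ y →
            ∀ z → adj (remove H u) w z ≡ true → z ≡ y
  pendant-after-remove H u w y hw uy z e with hw z (remove-⊆ H u e)
  ... | inj₂ zy = zy
  ... | inj₁ zu = ⊥-elim (neqᵇ⇒≢ (∧∧≡true⇒₃ {adj H w z} {neqᵇ w u} {neqᵇ z u} e) zu)

  powSum-empty : ∀ (H : Graph n) S → Supp H S → (∀ v → S v ≡ false) → powSum p H ≡ 0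
  powSum-empty H S sp none = ∑-zero _ (λ a → cong (_^ p) (deg≡0 H a (λ z → f a z)))
    where
    f : ∀ a z → adj H a z ≡ false
    f a z with true⊎false {n} (adj H a z)
    ... | inj₂ x = x
    ... | inj₁ t = ⊥-elim (false≢true (trans (sym (none a)) (sp a z t)))

  powSum≤φ-fuel : ∀ f (H : Graph n) (S : Fin n → Bool) → size S ≤ f → Supp H S → ¬ HasEvenCycle H → powSum p H ≤ φ (size S)
  powSum≤φ-fuel f H S le sp ne with find S
  ... | inj₂ none = subst (_≤ φ (size S)) (sym (powSum-empty H S sp none)) z≤n
  powSum≤φ-fuel zero H S le sp ne | inj₁ (v0 , sv0) with subst (_≤ 0) (size-without S v0 sv0) le
  ... | ()
  powSum≤φ-fuel (suc f) H S le sp ne | inj₁ (v0 , sv0) with Configurations.configuration H S sp ne v0 sv0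
  ... | Configurations.isolated v sv h = subst (λ t → powSum p H ≤ φ t) (sym (size-without S v sv))
        (≤-trans (≤-reflexive (powSum-remove-isolated H v h))
        (≤-trans (powSum≤φ-fuel f (remove H v) (without S v) le' (Supp-remove H S v sp) (noEven-remove H v ne)) (φ-mono (size (without S v)))))
    where le' = ≤-pred (subst (_≤ suc f) (size-without S v sv) le)
  ... | Configurations.pendant v x h ax with +1≤⇒suc (deg+1≤size (remove H v) (without S v) (Supp-remove H S v sp) x
                     (without-member S v x (Supp-target H S sp v x ax) (λ e → adj⇒≢ H ax (sym e))))
  ... | k , ek , dk = subst (λ t → powSum p H ≤ φ t) (sym (trans (size-without S v (sp v x ax)) (cong suc ek))) (begin
        powSum p H ≡⟨ powSum-remove-pendant H v x h ax ⟩
        powSum p H' + 1 + Δ p (deg H' x) ≤⟨ +-mono-≤ (+-monoˡ-≤ 1 IH) (Δ-mono-≤ p dk) ⟩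
        φ (suc k) + 1 + Δ p k ≤⟨ φ-pendant-≤ k ⟩
        φ (suc (suc k)) ∎)
    where
    open ≤-Reasoning
    H' = remove H v
    le' = ≤-pred (subst (_≤ suc f) (size-without S v (sp v x ax)) le)
    IH : powSum p H' ≤ φ (suc k)
    IH = subst (λ t → powSum p H' ≤ φ t) ek (powSum≤φ-fuel f H' (without S v) le' (Supp-remove H S v sp) (noEven-remove H v ne))
  powSum≤φ-fuel (suc f) H S le sp ne | inj₁ (v0 , sv0) | Configurations.suspended u w x y hu auw aux wx hw awy uy
    with +1≤⇒suc (deg+1≤size (remove (remove H u) w) (without (without S u) w) (Supp-remove (remove H u) (without S u) w (Supp-remove H S u sp)) y yS2)
    where
    yS2 : without (without S u) w y ≡ true
    yS2 = without-member (without S u) w y (without-member S u y (Supp-target H S sp w y awy) (λ e → uy (sym e))) (λ e → adj⇒≢ H awy (sym e))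
  ... | k , ek , dk = subst (λ t → powSum p H ≤ φ t) (sym eS) (begin
        powSum p H ≡⟨ powSum-remove-deg2 H u w x hu auw aux wx ⟩
        powSum p H1 + 2 ^ p + Δ p (deg H1 w) + Δ p (deg H1 x) ≡⟨ cong₂ (λ s t → s + 2 ^ p + Δ p t + Δ p (deg H1 x)) (powSum-remove-pendant H1 w y hw1 a1wy) dw1 ⟩
        (powSum p H2 + 1 + Δ p (deg H2 y)) + 2 ^ p + Δ p 1 + Δ p (deg H1 x)
           ≤⟨ +-mono-≤ (+-monoˡ-≤ (Δ p 1) (+-monoˡ-≤ (2 ^ p) (+-mono-≤ (+-monoˡ-≤ 1 IH) (Δ-mono-≤ p dk)))) (Δ-mono-≤ p dx) ⟩
        (φ (suc k) + 1 + Δ p k) + 2 ^ p + Δ p 1 + Δ p (suc k) ≡⟨ L (φ (suc k)) (Δ p k) (Δ p (suc k)) (Δ p 1) (2 ^ p) 1+Δ1≡2^p ⟩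
        φ (suc k) + (2 ^ p + 2 ^ p) + Δ p (suc k) + Δ p k ≡⟨ sym (φ-suspended k) ⟩
        φ (suc (suc (suc k))) ∎)
    where
    open ≤-Reasoning
    L0 : ∀ a b c F1 → (a + 1 + b) + (1 + F1) + F1 + c ≡ a + ((1 + F1) + (1 + F1)) + c + b
    L0 = solve-∀
    L : ∀ a b c F1 P → 1 + F1 ≡ P → (a + 1 + b) + P + F1 + c ≡ a + (P + P) + c + b
    L a b c F1 .(1 + F1) refl = L0 a b c F1
    H1 = remove H u
    S1 = without S u
    H2 = remove H1 w
    S2 = without S1 w
    wu : w ≢ u
    wu e = adj⇒≢ H auw (sym e)
    yu : y ≢ u
    yu e = uy (sym e)
    wS1 : S1 w ≡ true
    wS1 = without-member S u w (Supp-target H S sp u w auw) wu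
    es1 = size-without S u (sp u w auw)
    es2 = size-without S1 w wS1
    eS : size S ≡ suc (suc (suc k))
    eS = trans es1 (cong suc (trans es2 (cong suc ek)))
    hw1 = pendant-after-remove H u w y hw uy
    a1wy : adj H1 w y ≡ true
    a1wy = trans (remove-adj H u wu yu) awy
    dw1 : deg H1 w ≡ 1
    dw1 = deg≡1 H1 w y hw1 a1wy
    xS1 : S1 x ≡ true
    xS1 = without-member S u x (Supp-target H S sp u x aux) (λ e → adj⇒≢ H aux (sym e))
    dx : deg H1 x ≤ suc k
    dx = +1≤suc⇒≤ (subst (deg H1 x + 1 ≤_) (trans es2 (cong suc ek)) (deg+1≤size H1 S1 (Supp-remove H S u sp) x xS1))
    le2 : size S2 ≤ f
    le2 = ≤-trans (n≤1+n _) (≤-pred (subst (_≤ suc f) (trans es1 (cong suc es2)) le))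
    IH : powSum p H2 ≤ φ (suc k)
    IH = subst (λ t → powSum p H2 ≤ φ t) ek (powSum≤φ-fuel f H2 S2 le2 (Supp-remove H1 S1 w (Supp-remove H S u sp)) (noEven-remove H1 w (noEven-remove H u ne)))

  powSum≤φ : ∀ (H : Graph n) S → Supp H S → ¬ HasEvenCycle H → powSum p H ≤ φ (size S)
  powSum≤φ H S sp ne = powSum≤φ-fuel (size S) H S ≤-refl sp ne

n/2≡⌊n/2⌋ : ∀ x → x / 2 ≡ ⌊ x /2⌋
n/2≡⌊n/2⌋ zero = refl
n/2≡⌊n/2⌋ (suc zero) = refl
n/2≡⌊n/2⌋ (suc (suc x)) = trans (divₕ-extractAcc 1 1 x 1) (cong suc (n/2≡⌊n/2⌋ x))

eqᵇ : ℕ → ℕ → Bool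
eqᵇ a b = ⌊ a ℕ.≟ b ⌋

friendAdjℕ : ℕ → ℕ → Bool
friendAdjℕ a b = not (eqᵇ a b) ∧ (eqᵇ a 0 ∨ eqᵇ b 0 ∨ eqᵇ (⌊ a ∸ 1 /2⌋) (⌊ b ∸ 1 /2⌋))

friendAdj≡friendAdjℕ : ∀ {n} (i j : Fin n) → friendAdj i j ≡ friendAdjℕ (toℕ i) (toℕ j)
friendAdj≡friendAdjℕ i j rewrite n/2≡⌊n/2⌋ (toℕ i ∸ 1) | n/2≡⌊n/2⌋ (toℕ j ∸ 1) = cong (λ t → not t ∧ (eqᵇ (toℕ i) 0 ∨ eqᵇ (toℕ j) 0 ∨ eqᵇ (⌊ toℕ i ∸ 1 /2⌋) (⌊ toℕ j ∸ 1 /2⌋))) (lem i j)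
  where
  lem : ∀ {n} (i j : Fin n) → ⌊ i ≟ j ⌋ ≡ eqᵇ (toℕ i) (toℕ j)
  lem i j with i ≟ j | toℕ i ℕ.≟ toℕ j
  ... | yes _ | yes _ = refl
  ... | no _ | no _ = refl
  ... | yes refl | no ne = ⊥-elim (ne refl)
  ... | no ne | yes e = ⊥-elim (ne (toℕ-injective e))

eqᵇ-refl : ∀ a → eqᵇ a a ≡ true
eqᵇ-refl a with a ℕ.≟ a
... | yes _ = refl
... | no ne = ⊥-elim (ne refl)

≢⇒eqᵇ-false : ∀ {a b} → a ≢ b → eqᵇ a b ≡ false
≢⇒eqᵇ-false {a} {b} ne with a ℕ.≟ b
... | yes e = ⊥-elim (ne e)
... | no _ = refl

eqᵇ-sym : ∀ a b → eqᵇ a b ≡ eqᵇ b a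
eqᵇ-sym a b with a ℕ.≟ b | b ℕ.≟ a
... | yes _ | yes _ = refl
... | no _ | no _ = refl
... | yes e | no ne = ⊥-elim (ne (sym e))
... | no ne | yes e = ⊥-elim (ne (sym e))

eqᵇ⇒≡ : ∀ {a b} → eqᵇ a b ≡ true → a ≡ b
eqᵇ⇒≡ {a} {b} e with a ℕ.≟ b
... | yes x = x
... | no _ = ⊥-elim (false≢true e)

friendAdjℕ-irrefl : ∀ a → friendAdjℕ a a ≡ false
friendAdjℕ-irrefl a rewrite eqᵇ-refl a = refl

∨-comm3 : ∀ x y z → (x ∨ y ∨ z) ≡ (y ∨ x ∨ z)
∨-comm3 false false z = refl
∨-comm3 false true z = refl
∨-comm3 true false z = refl
∨-comm3 true true z = refl

friendAdjℕ-sym : ∀ a b → friendAdjℕ a b ≡ friendAdjℕ b a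
friendAdjℕ-sym a b rewrite eqᵇ-sym a b | eqᵇ-sym (⌊ a ∸ 1 /2⌋) (⌊ b ∸ 1 /2⌋) | ∨-comm3 (eqᵇ a 0) (eqᵇ b 0) (eqᵇ (⌊ b ∸ 1 /2⌋) (⌊ a ∸ 1 /2⌋)) = refl

⌊1+n/2⌋-even : ∀ t → isEven t ≡ true → ⌊ suc t /2⌋ ≡ ⌊ t /2⌋
⌊1+n/2⌋-even zero _ = refl
⌊1+n/2⌋-even (suc zero) ()
⌊1+n/2⌋-even (suc (suc t)) e = cong suc (⌊1+n/2⌋-even t (trans (sym (not-involutive (isEven t))) e))

⌊n/2⌋-<-even : ∀ a b → isEven a ≡ true → b < a → ⌊ b /2⌋ < ⌊ a /2⌋
⌊n/2⌋-<-even zero b _ ()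
⌊n/2⌋-<-even (suc zero) b () _
⌊n/2⌋-<-even (suc (suc a)) zero e _ = s≤s z≤n
⌊n/2⌋-<-even (suc (suc a)) (suc zero) e _ = s≤s z≤n
⌊n/2⌋-<-even (suc (suc a)) (suc (suc b)) e (s≤s (s≤s lt)) = s≤s (⌊n/2⌋-<-even a b (trans (sym (not-involutive (isEven a))) e) lt)

friendAdjℕ-odd-below : ∀ m j → isEven m ≡ false → j < m → friendAdjℕ m j ≡ eqᵇ j 0
friendAdjℕ-odd-below (suc t) zero e lt = refl
friendAdjℕ-odd-below (suc t) (suc j) e (s≤s lt) rewrite ≢⇒eqᵇ-false {suc t} {suc j} (λ eq → <-irrefl (sym eq) (s≤s lt))
  = ≢⇒eqᵇ-false (λ eq → <-irrefl (sym eq) (⌊n/2⌋-<-even t j et lt))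
  where et = isEven-pred-of-odd t e

friendAdjℕ-partner : ∀ m → isEven m ≡ false → friendAdjℕ m (suc m) ≡ true
friendAdjℕ-partner (suc t) e
  rewrite ≢⇒eqᵇ-false {suc t} {suc (suc t)} (λ eq → <-irrefl eq (n<1+n _))
        | ⌊1+n/2⌋-even t (isEven-pred-of-odd t e) | eqᵇ-refl ⌊ t /2⌋ = refl

friendAdjℕ-partner-below : ∀ m j → isEven m ≡ false → j < m → friendAdjℕ (suc m) j ≡ eqᵇ j 0
friendAdjℕ-partner-below (suc t) zero e lt = refl
friendAdjℕ-partner-below (suc t) (suc j) e (s≤s lt) rewrite ≢⇒eqᵇ-false {suc (suc t)} {suc j} (λ eq → <-irrefl (sym eq) (≤-trans (s≤s lt) (n≤1+n _))) | ⌊1+n/2⌋-even t (isEven-pred-of-odd t e)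
  = ≢⇒eqᵇ-false (λ eq → <-irrefl (sym eq) (⌊n/2⌋-<-even t j et lt))
  where et = isEven-pred-of-odd t e

module _ {n : ℕ} where

  -- g 0, …, g (m ∸ 1) enumerate S so that H on S is a copy of F_m, with centre g 0.
  record Labelling (H : Graph n) (S : Fin n → Bool) (m : ℕ) (g : ℕ → Fin n) : Set where
    field
      lab-inj : ∀ i j → i < m → j < m → g i ≡ g j → i ≡ j
      lab-∈ : ∀ i → i < m → S (g i) ≡ true
      lab-onto : ∀ a → S a ≡ true → Σ ℕ λ i → i < m × g i ≡ a
      lab-adj : ∀ i j → i < m → j < m → adj H (g i) (g j) ≡ friendAdjℕ i j
  open Labelling public

  LabelledAt : Graph n → (Fin n → Bool) → Fin n → Set
  LabelledAt H S c = Σ (ℕ → Fin n) λ g → Labelling H S (size S) g × g 0 ≡ c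

  update : (ℕ → Fin n) → ℕ → Fin n → ℕ → Fin n
  update g m v i = if eqᵇ i m then v else g i

  update-at : ∀ g m v → update g m v m ≡ v
  update-at g m v rewrite eqᵇ-refl m = refl

  update-off : ∀ g m v i → i ≢ m → update g m v i ≡ g i
  update-off g m v i ne rewrite ≢⇒eqᵇ-false ne = refl

  restrict : ∀ {H S m g} → Labelling H S (suc m) g → Labelling (remove H (g m)) (without S (g m)) m g
  restrict {H} {S} {m} {g} L = record
    { lab-inj = λ i j li lj e → lab-inj L i j (≤-trans li (n≤1+n _)) (≤-trans lj (n≤1+n _)) e
    ; lab-∈ = λ i li → without-member S (g m) (g i) (lab-∈ L i (≤-trans li (n≤1+n _)))
                       (λ e → <-irrefl (lab-inj L i m (≤-trans li (n≤1+n _)) ≤-refl e) li)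
    ; lab-onto = sur
    ; lab-adj = λ i j li lj → trans (remove-adj H (g m) (ne i li) (ne j lj)) (lab-adj L i j (≤-trans li (n≤1+n _)) (≤-trans lj (n≤1+n _))) }
    where
    ne : ∀ i → i < m → g i ≢ g m
    ne i li e = <-irrefl (lab-inj L i m (≤-trans li (n≤1+n _)) ≤-refl e) li
    sur : ∀ a → without S (g m) a ≡ true → Σ ℕ λ i → i < m × g i ≡ a
    sur a e with lab-onto L a (∧≡true⇒ˡ e)
    ... | i , li , gi with <-suc⇒≡⊎< li
    ...   | inj₁ refl = ⊥-elim (neqᵇ⇒≢ (∧≡true⇒ʳ {S a} e) (sym gi))
    ...   | inj₂ l = i , l , gi

  size-empty : ∀ (S : Fin n → Bool) → (∀ a → S a ≡ false) → size S ≡ 0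
  size-empty S h = ∑-zero {n} _ (λ a → cong 𝟙 (h a))

  labelling-size : ∀ {H S} m {g} → Labelling H S m g → size S ≡ m
  labelling-size {H} {S} zero L = size-empty S f
    where f : ∀ a → S a ≡ false
          f a with true⊎false {n} (S a)
          ... | inj₂ x = x
          ... | inj₁ t with lab-onto L a t
          ...   | _ , () , _
  labelling-size {H} {S} (suc m) {g} L = trans (size-without S (g m) (lab-∈ L m ≤-refl)) (cong suc (labelling-size m (restrict L)))

  injective⇒onto : ∀ m (S : Fin n → Bool) (g : ℕ → Fin n) → (∀ i j → i < m → j < m → g i ≡ g j → i ≡ j) →
         (∀ i → i < m → S (g i) ≡ true) → size S ≡ m → ∀ a → S a ≡ true → Σ ℕ λ i → i < m × g i ≡ a
  injective⇒onto zero S g inj ins sz a sa with subst (_≡ 0) (size-without S a sa) sz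
  ... | ()
  injective⇒onto (suc m) S g inj ins sz a sa with toSum (g m ≟ a)
  ... | inj₁ e = m , ≤-refl , e
  ... | inj₂ ne with injective⇒onto m (without S (g m)) g (λ i j li lj → inj i j (≤-trans li (n≤1+n _)) (≤-trans lj (n≤1+n _)))
                    (λ i li → without-member S (g m) (g i) (ins i (≤-trans li (n≤1+n _))) (λ e → <-irrefl (inj i m (≤-trans li (n≤1+n _)) ≤-refl e) li))
                    (suc-injective (trans (sym (size-without S (g m) (ins m ≤-refl))) sz)) a (without-member S (g m) a sa (λ e → ne (sym e)))
  ...   | i , li , gi = i , ≤-trans li (n≤1+n _) , gi

  all-adjacent⇒deg : ∀ (H : Graph n) S c → Supp H S → S c ≡ true → (∀ a → S a ≡ true → a ≢ c → adj H c a ≡ true) → deg H c + 1 ≡ size S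
  all-adjacent⇒deg H S c sp sc h = trans (cong (deg H c +_) (sym (∑-single c 1))) (trans (sym (∑-distrib-+ {n} _ _)) (sum-cong-≗ pw))
    where
    pw : ∀ z → 𝟙 (adj H c z) + single c 1 z ≡ 𝟙 (S z)
    pw z with toSum (z ≟ c)
    ... | inj₁ refl rewrite irrefl H z | sc | single-at z 1 = refl
    ... | inj₂ ne rewrite single-off c z 1 ne with true⊎false {n} (S z)
    ...   | inj₁ t rewrite t | h z t ne = refl
    ...   | inj₂ f rewrite f with true⊎false {n} (adj H c z)
    ...     | inj₁ t = ⊥-elim (false≢true (trans (sym f) (Supp-target H S sp c z t)))
    ...     | inj₂ f' rewrite f' = refl

  𝟙-adj≤𝟙 : ∀ (H : Graph n) S → Supp H S → ∀ c z → 𝟙 (adj H c z) ≤ 𝟙 (S z)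
  𝟙-adj≤𝟙 H S sp c z with true⊎false {n} (adj H c z)
  ... | inj₁ t rewrite t | Supp-target H S sp c z t = ≤-refl
  ... | inj₂ f rewrite f = z≤n

  full⇒adjacent : ∀ (H : Graph n) S c → Supp H S → S c ≡ true → deg H c + 1 ≡ size S → ∀ a → S a ≡ true → a ≢ c → adj H c a ≡ true
  full⇒adjacent H S c sp sc eq a sa ne with true⊎false {n} (adj H c a)
  ... | inj₁ t = t
  ... | inj₂ f = ⊥-elim (<-irrefl refl (≤-trans (≤-reflexive (cong suc (sym eq))) (subst (_≤ size S) (lem (deg H c)) le)))
    where
    pw : ∀ z → 𝟙 (adj H c z) + (single c 1 z + single a 1 z) ≤ 𝟙 (S z)
    pw z with toSum (z ≟ c) | toSum (z ≟ a)
    ... | inj₁ refl | inj₁ refl = ⊥-elim (ne refl)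
    ... | inj₁ refl | inj₂ za rewrite irrefl H z | single-at z 1 | single-off a z 1 za | sc = ≤-refl
    ... | inj₂ zc | inj₁ refl rewrite f | single-off c z 1 zc | single-at z 1 | sa = ≤-refl
    ... | inj₂ zc | inj₂ za rewrite single-off c z 1 zc | single-off a z 1 za | +-identityʳ (𝟙 (adj H c z)) = 𝟙-adj≤𝟙 H S sp c z
    lem : ∀ d → d + 2 ≡ suc (d + 1)
    lem d = +-suc d 1
    le : deg H c + 2 ≤ size S
    le = subst (_≤ size S) (trans (∑-distrib-+ {n} _ _) (cong (deg H c +_) (trans (∑-distrib-+ {n} _ _) (cong₂ _+_ (∑-single c 1) (∑-single a 1))))) (∑-mono-≤ pw)

  extend-labelling : ∀ (H : Graph n) S v m g' → S v ≡ true → Labelling (remove H v) (without S v) m g' →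
        (∀ j → j < m → adj H v (g' j) ≡ friendAdjℕ m j) → Labelling H S (suc m) (update g' m v)
  extend-labelling H S v m g' sv L h = record { lab-inj = lin' ; lab-∈ = lS' ; lab-onto = lsur' ; lab-adj = ladj' }
    where
    G' = update g' m v
    gne : ∀ j → j < m → g' j ≢ v
    gne j lj = neqᵇ⇒≢ (∧≡true⇒ʳ {S (g' j)} (lab-∈ L j lj))
    ltne : ∀ {j} → j < m → j ≢ m
    ltne lj e = <-irrefl e lj
    lin' : ∀ i j → i < suc m → j < suc m → G' i ≡ G' j → i ≡ j
    lin' i j li lj e with <-suc⇒≡⊎< li | <-suc⇒≡⊎< lj
    ... | inj₁ refl | inj₁ refl = refl
    ... | inj₁ refl | inj₂ l = ⊥-elim (gne j l (sym (trans (sym (update-at g' m v)) (trans e (update-off g' m v j (ltne l))))))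
    ... | inj₂ l | inj₁ refl = ⊥-elim (gne i l (trans (sym (update-off g' m v i (ltne l))) (trans e (update-at g' m v))))
    ... | inj₂ l | inj₂ l' = lab-inj L i j l l' (trans (sym (update-off g' m v i (ltne l))) (trans e (update-off g' m v j (ltne l'))))
    lS' : ∀ i → i < suc m → S (G' i) ≡ true
    lS' i li with <-suc⇒≡⊎< li
    ... | inj₁ refl rewrite update-at g' m v = sv
    ... | inj₂ l rewrite update-off g' m v i (ltne l) = ∧≡true⇒ˡ (lab-∈ L i l)
    lsur' : ∀ a → S a ≡ true → Σ ℕ λ i → i < suc m × G' i ≡ a
    lsur' a sa with toSum (a ≟ v)
    ... | inj₁ refl = m , ≤-refl , update-at g' m a
    ... | inj₂ ne with lab-onto L a (without-member S v a sa ne)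
    ...   | i , li , gi = i , ≤-trans li (n≤1+n _) , trans (update-off g' m v i (ltne li)) gi
    ladj' : ∀ i j → i < suc m → j < suc m → adj H (G' i) (G' j) ≡ friendAdjℕ i j
    ladj' i j li lj with <-suc⇒≡⊎< li | <-suc⇒≡⊎< lj
    ... | inj₁ refl | inj₁ refl rewrite update-at g' m v | irrefl H v = sym (friendAdjℕ-irrefl m)
    ... | inj₁ refl | inj₂ l rewrite update-at g' m v | update-off g' m v j (ltne l) = h j l
    ... | inj₂ l | inj₁ refl rewrite update-at g' m v | update-off g' m v i (ltne l) = trans (adj-comm H (g' i) v) (trans (h i l) (friendAdjℕ-sym m i))
    ... | inj₂ l | inj₂ l' rewrite update-off g' m v i (ltne l) | update-off g' m v j (ltne l') =
          trans (sym (remove-adj H v (gne i l) (gne j l'))) (lab-adj L i j l l')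

  friendAdjℕ-<3 : ∀ i j → i < 3 → j < 3 → i ≢ j → friendAdjℕ i j ≡ true
  friendAdjℕ-<3 zero zero _ _ ne = ⊥-elim (ne refl)
  friendAdjℕ-<3 zero (suc j) _ _ _ = refl
  friendAdjℕ-<3 (suc i) zero _ _ _ = refl
  friendAdjℕ-<3 1 1 _ _ ne = ⊥-elim (ne refl)
  friendAdjℕ-<3 1 2 _ _ _ = refl
  friendAdjℕ-<3 2 1 _ _ _ = refl
  friendAdjℕ-<3 2 2 _ _ ne = ⊥-elim (ne refl)
  friendAdjℕ-<3 (suc (suc (suc i))) _ (s≤s (s≤s (s≤s ()))) _ _
  friendAdjℕ-<3 1 (suc (suc (suc j))) _ (s≤s (s≤s (s≤s ()))) _
  friendAdjℕ-<3 2 (suc (suc (suc j))) _ (s≤s (s≤s (s≤s ()))) _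

  small-labelling : ∀ (H : Graph n) S m g → m ≤ 3 → (∀ i j → i < m → j < m → g i ≡ g j → i ≡ j) →
             (∀ i → i < m → S (g i) ≡ true) → size S ≡ m →
             (∀ i j → i < m → j < m → i ≢ j → adj H (g i) (g j) ≡ true) → Labelling H S m g
  small-labelling H S m g m3 inj ins sz cmp = record
    { lab-inj = inj ; lab-∈ = ins ; lab-onto = injective⇒onto m S g inj ins sz ; lab-adj = la }
    where
    la : ∀ i j → i < m → j < m → adj H (g i) (g j) ≡ friendAdjℕ i j
    la i j li lj with toSum (i ℕ.≟ j)
    ... | inj₁ refl rewrite irrefl H (g i) = sym (friendAdjℕ-irrefl i)
    ... | inj₂ ne = trans (cmp i j li lj ne) (sym (friendAdjℕ-<3 i j (≤-trans li m3) (≤-trans lj m3) ne))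

  labelled-neighbour : ∀ {H : Graph n} {S m g} → Labelling H S m g → Supp H S → ∀ t b → t < m → adj H (g t) b ≡ true →
            Σ ℕ λ j → j < m × g j ≡ b × friendAdjℕ t j ≡ true
  labelled-neighbour {H} {S} {m} {g} L sp t b lt e with lab-onto L b (Supp-target H S sp (g t) b e)
  ... | j , lj , gj = j , lj , gj , trans (sym (lab-adj L t j lt lj)) (subst (λ z → adj H (g t) z ≡ true) (sym gj) e)

  labelled-centre-deg : ∀ {H : Graph n} {S m g} → Labelling H S (suc m) g → Supp H S → deg H (g 0) + 1 ≡ suc m
  labelled-centre-deg {H} {S} {m} {g} L sp = trans (all-adjacent⇒deg H S (g 0) sp (lab-∈ L 0 (s≤s z≤n)) f) (labelling-size (suc m) L)
    where
    f : ∀ a → S a ≡ true → a ≢ g 0 → adj H (g 0) a ≡ true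
    f a sa ne with lab-onto L a sa
    ... | zero , lj , gj = ⊥-elim (ne (sym gj))
    ... | suc j , lj , gj = subst (λ z → adj H (g 0) z ≡ true) gj (trans (lab-adj L 0 (suc j) (s≤s z≤n) lj) refl)

  labelled-odd-neighbour : ∀ (H : Graph n) S g k → Supp H S → Labelling H S (suc (suc k)) g → isEven (suc k) ≡ false →
             ∀ z → adj H (g (suc k)) z ≡ true → z ≡ g 0
  labelled-odd-neighbour H S g k sp L ek z e = go (labelled-neighbour L sp (suc k) z ≤-refl e)
    where
    go : Σ ℕ (λ j → j < suc (suc k) × g j ≡ z × friendAdjℕ (suc k) j ≡ true) → z ≡ g 0
    go (j , lj , gj , fj) with <-suc⇒≡⊎< lj
    ... | inj₁ refl = ⊥-elim (adj⇒≢ H e gj)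
    ... | inj₂ l = trans (sym gj) (cong g (eqᵇ⇒≡ {j} {0} (trans (sym (friendAdjℕ-odd-below (suc k) j ek l)) fj)))

module LabelledValue (q : ℕ) {n : ℕ} where
  open Exponent q
  open PowSumRemoval (suc q) {n}
  open UpperBound q {n}

  powSum-edgeless : ∀ (H : Graph n) → (∀ a b → adj H a b ≡ false) → powSum p H ≡ 0
  powSum-edgeless H h = powSum-empty H (λ _ → false) (λ a b e → trans (sym (h a b)) e) (λ _ → refl)

  labelled-step : ∀ k (H : Graph n) S g → Supp H S → Labelling H S (suc (suc k)) g →
          powSum p (remove H (g (suc k))) ≡ φ (suc k) → powSum p H ≡ φ (suc (suc k))

  labelled-step-odd : ∀ k (H : Graph n) S g → Supp H S → Labelling H S (suc (suc k)) g → isEven (suc k) ≡ true →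
          powSum p (remove H (g (suc k))) ≡ φ (suc k) → powSum p H ≡ φ (suc (suc k))

  labelled⇒powSum≡φ : ∀ m (H : Graph n) S g → Supp H S → Labelling H S m g → powSum p H ≡ φ m
  labelled⇒powSum≡φ zero H S g sp L = powSum-edgeless H f
    where
    f : ∀ a b → adj H a b ≡ false
    f a b with true⊎false {n} (adj H a b)
    ... | inj₂ x = x
    ... | inj₁ t with lab-onto L a (sp a b t)
    ...   | _ , () , _
  labelled⇒powSum≡φ (suc zero) H S g sp L = powSum-edgeless H f
    where
    f : ∀ a b → adj H a b ≡ false
    f a b with true⊎false {n} (adj H a b)
    ... | inj₂ x = x
    ... | inj₁ t with lab-onto L a (sp a b t) | lab-onto L b (Supp-target H S sp a b t)
    ...   | zero , _ , ga | zero , _ , gb = ⊥-elim (adj⇒≢ H t (trans (sym ga) gb))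
    ...   | suc _ , s≤s () , _ | _
    ...   | zero , _ , _ | suc _ , s≤s () , _
  labelled⇒powSum≡φ (suc (suc k)) H S g sp L = labelled-step k H S g sp L (labelled⇒powSum≡φ (suc k) (remove H (g (suc k))) (without S (g (suc k))) g (Supp-remove H S (g (suc k)) sp) (restrict L))

  labelled-step k H S g sp L IH with true⊎false {n} (isEven (suc k))
  ... | inj₂ ek = begin
      powSum p H ≡⟨ powSum-remove-pendant H v c hv avc ⟩
      powSum p H' + 1 + Δ p (deg H' c) ≡⟨ cong₂ (λ a b → a + 1 + Δ p b) IH dc ⟩
      φ (suc k) + 1 + Δ p k ≡⟨ lem (φ (suc k)) (Δ p k) ⟩
      φ (suc k) + Δ p k + 1 ≡⟨ cong (φ (suc k) + Δ p k +_) (sym bon) ⟩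
      φ (suc (suc k)) ∎
    where
    open ≡-Reasoning
    v = g (suc k)
    c = g 0
    H' = remove H v
    L' = restrict L
    sp' = Supp-remove H S v sp
    dc : deg H' c ≡ k
    dc = +1≡suc⇒≡ (labelled-centre-deg L' sp')
    lem : ∀ a b → a + 1 + b ≡ a + b + 1
    lem = solve-∀
    bon : bonus k ≡ 1
    bon rewrite isEven-pred-of-odd k ek = refl
    hv = labelled-odd-neighbour H S g k sp L ek
    avc : adj H v c ≡ true
    avc = lab-adj L (suc k) 0 ≤-refl (s≤s z≤n)
  ... | inj₁ ek = labelled-step-odd k H S g sp L ek IH

  labelled-step-odd zero H S g sp L ek IH = ⊥-elim (false≢true ek)
  labelled-step-odd (suc k') H S g sp L ek IH = begin
      powSum p H ≡⟨ powSum-remove-deg2 H v w c hv avw avc wc ⟩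
      powSum p H' + 2 ^ p + Δ p (deg H' w) + Δ p (deg H' c) ≡⟨ cong₃ IH dw dc ⟩
      φ (suc k) + 2 ^ p + Δ p 1 + Δ p k ≡⟨ lem (φ (suc k)) (2 ^ p) (Δ p 1) (Δ p k) ⟩
      φ (suc k) + Δ p k + (2 ^ p + Δ p 1) ≡⟨ cong (φ (suc k) + Δ p k +_) (sym bon) ⟩
      φ (suc (suc k)) ∎
    where
    open ≡-Reasoning
    k = suc k'
    v = g (suc k)
    w = g k
    c = g 0
    H' = remove H v
    L' = restrict L
    sp' = Supp-remove H S v sp
    ek' : isEven k ≡ false
    ek' = isEven-pred-of-even k ek
    cong₃ : ∀ {a b d e f} → a ≡ b → d ≡ 1 → e ≡ f → a + 2 ^ p + Δ p d + Δ p e ≡ b + 2 ^ p + Δ p 1 + Δ p f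
    cong₃ refl refl refl = refl
    dc : deg H' c ≡ k
    dc = +1≡suc⇒≡ (labelled-centre-deg L' sp')
    dw : deg H' w ≡ 1
    dw = deg≡1 H' w c (labelled-odd-neighbour H' (without S v) g k' sp' L' ek') (lab-adj L' k 0 ≤-refl (s≤s z≤n))
    lem : ∀ a b c d → a + b + c + d ≡ a + d + (b + c)
    lem = solve-∀
    bon : bonus k ≡ 2 ^ p + Δ p 1
    bon rewrite ek' = refl
    hv : ∀ z → adj H v z ≡ true → z ≡ w ⊎ z ≡ c
    hv z e = go (labelled-neighbour L sp (suc k) z ≤-refl e)
      where
      go : Σ ℕ (λ j → j < suc (suc k) × g j ≡ z × friendAdjℕ (suc k) j ≡ true) → z ≡ w ⊎ z ≡ c
      go (j , lj , gj , fj) with <-suc⇒≡⊎< lj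
      ... | inj₁ refl = ⊥-elim (adj⇒≢ H e gj)
      ... | inj₂ l with <-suc⇒≡⊎< l
      ...   | inj₁ refl = inj₁ (sym gj)
      ...   | inj₂ l' = inj₂ (trans (sym gj) (cong g (eqᵇ⇒≡ {j} {0} (trans (sym (friendAdjℕ-partner-below k j ek' l')) fj))))
    avw : adj H v w ≡ true
    avw = trans (lab-adj L (suc k) k ≤-refl (n≤1+n _)) (trans (friendAdjℕ-sym (suc k) k) (friendAdjℕ-partner k ek'))
    avc : adj H v c ≡ true
    avc = lab-adj L (suc k) 0 ≤-refl (s≤s z≤n)
    wc : w ≢ c
    wc e with lab-inj L k 0 (n≤1+n _) (s≤s z≤n) e
    ... | ()

-- In the equality case every inequality used in powSum≤φ-fuel is an equality.
module Tightness (q : ℕ) {n : ℕ} where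
  open Exponent q
  open PowSumRemoval (suc q) {n}
  open UpperBound q {n}

  tight-isolated : ∀ (H : Graph n) S → Supp H S → ¬ HasEvenCycle H → powSum p H ≡ φ (size S) →
       ∀ v → S v ≡ true → (∀ z → adj H v z ≡ false) → size S ≡ 1
  tight-isolated H S sp ne tight v sv h with size (without S v) in es'
  ... | zero = trans (size-without S v sv) (cong suc es')
  ... | suc k = ⊥-elim (<-irrefl refl (≤-trans (φ-< k) (≤-trans (≤-reflexive (sym e1)) b)))
    where
    e1 : powSum p H ≡ φ (suc (suc k))
    e1 = trans tight (cong φ (trans (size-without S v sv) (cong suc es')))
    b : powSum p H ≤ φ (suc k)
    b = subst (λ t → powSum p H ≤ φ t) es' (≤-trans (≤-reflexive (powSum-remove-isolated H v h)) (powSum≤φ (remove H v) (without S v) (Supp-remove H S v sp) (noEven-remove H v ne)))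

  tight-pendant : ∀ (H : Graph n) S → Supp H S → ¬ HasEvenCycle H → powSum p H ≡ φ (size S) →
       ∀ v x → (∀ z → adj H v z ≡ true → z ≡ x) → adj H v x ≡ true →
       Σ ℕ λ k → size (without S v) ≡ suc k × powSum p (remove H v) ≡ φ (suc k) × deg (remove H v) x ≡ k × isEven k ≡ true
  tight-pendant H S sp ne tight v x h ax with +1≤⇒suc (deg+1≤size (remove H v) (without S v) (Supp-remove H S v sp) x
                     (without-member S v x (Supp-target H S sp v x ax) (λ e → adj⇒≢ H ax (sym e))))
  ... | k , ek , dk = k , ek , proj₁ eqs , Δ-injective dk (proj₂ eqs) , evk
    where
    H' = remove H v
    d = deg H' x
    eS : size S ≡ suc (suc k)
    eS = trans (size-without S v (sp v x ax)) (cong suc ek)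
    B : powSum p H' ≤ φ (suc k)
    B = subst (λ t → powSum p H' ≤ φ t) ek (powSum≤φ H' (without S v) (Supp-remove H S v sp) (noEven-remove H v ne))
    E : powSum p H' + 1 + Δ p d ≡ φ (suc (suc k))
    E = trans (sym (powSum-remove-pendant H v x h ax)) (trans tight (cong φ eS))
    le1 : powSum p H' + 1 + Δ p d ≤ φ (suc k) + 1 + Δ p k
    le1 = +-mono-≤ (+-monoˡ-≤ 1 B) (Δ-mono-≤ p dk)
    e2 : powSum p H' + 1 + Δ p d ≡ φ (suc k) + 1 + Δ p k
    e2 = ≤-antisym le1 (≤-trans (φ-pendant-≤ k) (≤-reflexive (sym E)))
    eqs0 = +-tight (+-monoˡ-≤ 1 B) (Δ-mono-≤ p dk) e2
    eqs : powSum p H' ≡ φ (suc k) × Δ p d ≡ Δ p k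
    eqs = +-cancelʳ-≡ 1 _ _ (proj₁ eqs0) , proj₂ eqs0
    evk : isEven k ≡ true
    evk with true⊎false {n} (isEven k)
    ... | inj₁ t = t
    ... | inj₂ f = ⊥-elim (<-irrefl refl (≤-trans (φ-pendant-< k f) (≤-reflexive (trans (sym E) e2))))

  tight-suspended : ∀ (H : Graph n) S → Supp H S → ¬ HasEvenCycle H → powSum p H ≡ φ (size S) →
       ∀ u w x y → (∀ z → adj H u z ≡ true → z ≡ w ⊎ z ≡ x) → adj H u w ≡ true → adj H u x ≡ true → w ≢ x →
       (∀ z → adj H w z ≡ true → z ≡ u ⊎ z ≡ y) → adj H w y ≡ true → u ≢ y →
       Σ ℕ λ k → size (without (without S u) w) ≡ suc k × size S ≡ suc (suc (suc k)) ×
                 powSum p (remove (remove H u) w) ≡ φ (suc k) × deg (remove H u) x ≡ suc k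
  tight-suspended H S sp ne tight u w x y hu auw aux wx hw awy uy
    with +1≤⇒suc (deg+1≤size (remove (remove H u) w) (without (without S u) w) (Supp-remove (remove H u) (without S u) w (Supp-remove H S u sp)) y yS2)
    where
    yS2 : without (without S u) w y ≡ true
    yS2 = without-member (without S u) w y (without-member S u y (Supp-target H S sp w y awy) (λ e → uy (sym e))) (λ e → adj⇒≢ H awy (sym e))
  ... | k , ek , dk = k , ek , eS , e2H , Δ-injective dx (proj₂ s1)
    where
    L0 : ∀ a b c F1 → (a + 1 + b) + (1 + F1) + F1 + c ≡ a + ((1 + F1) + (1 + F1)) + c + b
    L0 = solve-∀
    L : ∀ a b c F1 P → 1 + F1 ≡ P → (a + 1 + b) + P + F1 + c ≡ a + (P + P) + c + b
    L a b c F1 .(1 + F1) refl = L0 a b c F1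
    H1 = remove H u
    S1 = without S u
    H2 = remove H1 w
    S2 = without S1 w
    wu : w ≢ u
    wu e = adj⇒≢ H auw (sym e)
    yu : y ≢ u
    yu e = uy (sym e)
    wS1 : S1 w ≡ true
    wS1 = without-member S u w (Supp-target H S sp u w auw) wu
    es1 = size-without S u (sp u w auw)
    es2 = size-without S1 w wS1
    eS : size S ≡ suc (suc (suc k))
    eS = trans es1 (cong suc (trans es2 (cong suc ek)))
    hw1 = pendant-after-remove H u w y hw uy
    a1wy : adj H1 w y ≡ true
    a1wy = trans (remove-adj H u wu yu) awy
    dw1 : deg H1 w ≡ 1
    dw1 = deg≡1 H1 w y hw1 a1wy
    xS1 : S1 x ≡ true
    xS1 = without-member S u x (Supp-target H S sp u x aux) (λ e → adj⇒≢ H aux (sym e))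
    dx : deg H1 x ≤ suc k
    dx = +1≤suc⇒≤ (subst (deg H1 x + 1 ≤_) (trans es2 (cong suc ek)) (deg+1≤size H1 S1 (Supp-remove H S u sp) x xS1))
    B : powSum p H2 ≤ φ (suc k)
    B = subst (λ t → powSum p H2 ≤ φ t) ek (powSum≤φ H2 S2 (Supp-remove H1 S1 w (Supp-remove H S u sp)) (noEven-remove H1 w (noEven-remove H u ne)))
    A0 = powSum p H2 + 1 + Δ p (deg H2 y) + 2 ^ p + Δ p 1
    A1 = φ (suc k) + 1 + Δ p k + 2 ^ p + Δ p 1
    la : A0 ≤ A1
    la = +-monoˡ-≤ (Δ p 1) (+-monoˡ-≤ (2 ^ p) (+-mono-≤ (+-monoˡ-≤ 1 B) (Δ-mono-≤ p dk)))
    E : A0 + Δ p (deg H1 x) ≡ powSum p H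
    E = sym (trans (powSum-remove-deg2 H u w x hu auw aux wx) (cong₂ (λ s t → s + 2 ^ p + Δ p t + Δ p (deg H1 x)) (powSum-remove-pendant H1 w y hw1 a1wy) dw1))
    top : A1 + Δ p (suc k) ≡ φ (suc (suc (suc k)))
    top = trans (L (φ (suc k)) (Δ p k) (Δ p (suc k)) (Δ p 1) (2 ^ p) 1+Δ1≡2^p) (sym (φ-suspended k))
    e1 : A0 + Δ p (deg H1 x) ≡ A1 + Δ p (suc k)
    e1 = trans E (trans tight (trans (cong φ eS) (sym top)))
    s1 = +-tight la (Δ-mono-≤ p dx) e1
    s2 = +-tight (+-monoˡ-≤ 1 B) (Δ-mono-≤ p dk) (+-cancelʳ-≡ (2 ^ p) _ _ (+-cancelʳ-≡ (Δ p 1) _ _ (proj₁ s1)))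
    e2H : powSum p H2 ≡ φ (suc k)
    e2H = +-cancelʳ-≡ 1 _ _ (proj₁ s2)

module Uniqueness (q : ℕ) {n : ℕ} where
  open Exponent q
  open Tightness q {n}

  adjacent-only-centre : ∀ (H : Graph n) (v c : Fin n) (m : ℕ) (g : ℕ → Fin n) → (∀ i j → i < m → j < m → g i ≡ g j → i ≡ j) → g 0 ≡ c →
             (∀ j → j < m → adj H v (g j) ≡ true → g j ≡ c) → adj H v c ≡ true → ∀ j → j < m → adj H v (g j) ≡ eqᵇ j 0
  adjacent-only-centre H v c m g inj g0 h avc j lj with toSum (j ℕ.≟ 0)
  ... | inj₁ refl = trans (cong (adj H v) g0) avc
  ... | inj₂ j0 with true⊎false {n} (adj H v (g j))
  ...   | inj₁ t = ⊥-elim (j0 (inj j 0 lj (≤-trans (s≤s z≤n) lj) (trans (h j lj t) (sym g0))))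
  ...   | inj₂ f = trans f (sym (≢⇒eqᵇ-false j0))

  LabelledBelow : ℕ → Set
  LabelledBelow f = ∀ (H : Graph n) S → size S ≤ f → Supp H S → ¬ HasEvenCycle H → powSum p H ≡ φ (size S) →
         ∀ c → S c ≡ true → deg H c + 1 ≡ size S → LabelledAt H S c

  label-pendant : ∀ f → LabelledBelow f → ∀ (H : Graph n) S → size S ≤ suc f → Supp H S → ¬ HasEvenCycle H → powSum p H ≡ φ (size S) →
         ∀ c v → S c ≡ true → (∀ z → adj H v z ≡ true → z ≡ c) → adj H v c ≡ true → deg H c + 1 ≡ size S →
         LabelledAt H S c
  extend-pendant : ∀ (H : Graph n) S c v k → Supp H S → (∀ z → adj H v z ≡ true → z ≡ c) → adj H v c ≡ true →
            size (without S v) ≡ suc k → isEven k ≡ true → (g' : ℕ → Fin n) → Labelling (remove H v) (without S v) (size (without S v)) g' → g' 0 ≡ c →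
            LabelledAt H S c
  extend-pendant H S c v k sp h avc ek evk g' L' g0 =
    update g' (suc k) v , subst (λ t → Labelling H S t (update g' (suc k) v)) (sym eS) Lx , trans (update-off g' (suc k) v 0 (λ ())) g0
    where
    S' = without S v
    sv = sp v c avc
    eS : size S ≡ suc (suc k)
    eS = trans (size-without S v sv) (cong suc ek)
    Lk : Labelling (remove H v) S' (suc k) g'
    Lk = subst (λ t → Labelling (remove H v) S' t g') ek L'
    Lx = extend-labelling H S v (suc k) g' sv Lk
           (λ j lj → trans (adjacent-only-centre H v c (suc k) g' (lab-inj Lk) g0 (λ j' _ t → h (g' j') t) avc j lj)
                           (sym (friendAdjℕ-odd-below (suc k) j (isEven-suc-of-even k evk) lj)))

  label-pendant f rec H S le sp ne tight c v sc h avc full = go (tight-pendant H S sp ne tight v c h avc)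
    where
    H' = remove H v
    S' = without S v
    sv = sp v c avc
    le' : size S' ≤ f
    le' = ≤-pred (subst (_≤ suc f) (size-without S v sv) le)
    cS' : S' c ≡ true
    cS' = without-member S v c sc (λ e → adj⇒≢ H avc (sym e))
    go : (Σ ℕ λ k → size S' ≡ suc k × powSum p H' ≡ φ (suc k) × deg H' c ≡ k × isEven k ≡ true) →
         LabelledAt H S c
    go (k , ek , eH' , dk , evk) = go2 (rec H' S' le' (Supp-remove H S v sp) (noEven-remove H v ne) (trans eH' (cong φ (sym ek))) c cS'
                                        (trans (cong (_+ 1) dk) (trans (+-comm k 1) (sym ek))))
      where
      go2 : LabelledAt H' S' c → LabelledAt H S c
      go2 (g' , L' , g0) = extend-pendant H S c v k sp h avc ek evk g' L' g0

  label-singleton : ∀ (H : Graph n) S c → S c ≡ true → size S ≡ 1 → LabelledAt H S c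
  label-singleton H S c sc e1 = (λ _ → c) , subst (λ t → Labelling H S t (λ _ → c)) (sym e1)
    (small-labelling H S 1 (λ _ → c) (s≤s z≤n) (λ i j li lj _ → trans (<1⇒≡0 li) (sym (<1⇒≡0 lj))) (λ _ _ → sc) e1
       (λ i j li lj ne → ⊥-elim (ne (trans (<1⇒≡0 li) (sym (<1⇒≡0 lj)))))) , refl

  enum₂ : Fin n → Fin n → ℕ → Fin n
  enum₂ a b zero = a
  enum₂ a b (suc _) = b

  enum₃ : Fin n → Fin n → Fin n → ℕ → Fin n
  enum₃ a b c zero = a
  enum₃ a b c (suc zero) = b
  enum₃ a b c (suc (suc _)) = c

  label-edge : ∀ (H : Graph n) S a b → Supp H S → adj H a b ≡ true → size S ≡ 2 → LabelledAt H S a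
  label-edge H S a b sp ab e2 = enum₂ a b , subst (λ t → Labelling H S t (enum₂ a b)) (sym e2)
    (small-labelling H S 2 (enum₂ a b) (s≤s (s≤s z≤n)) inj ins e2 cmp) , refl
    where
    ne : a ≢ b
    ne = adj⇒≢ H ab
    inj : ∀ i j → i < 2 → j < 2 → enum₂ a b i ≡ enum₂ a b j → i ≡ j
    inj i j li lj e with <2-cases li | <2-cases lj
    ... | inj₁ refl | inj₁ refl = refl
    ... | inj₁ refl | inj₂ refl = ⊥-elim (ne e)
    ... | inj₂ refl | inj₁ refl = ⊥-elim (ne (sym e))
    ... | inj₂ refl | inj₂ refl = refl
    ins : ∀ i → i < 2 → S (enum₂ a b i) ≡ true
    ins i li with <2-cases li
    ... | inj₁ refl = sp a b ab
    ... | inj₂ refl = Supp-target H S sp a b ab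
    cmp : ∀ i j → i < 2 → j < 2 → i ≢ j → adj H (enum₂ a b i) (enum₂ a b j) ≡ true
    cmp i j li lj nij with <2-cases li | <2-cases lj
    ... | inj₁ refl | inj₁ refl = ⊥-elim (nij refl)
    ... | inj₁ refl | inj₂ refl = ab
    ... | inj₂ refl | inj₁ refl = adj-sym H ab
    ... | inj₂ refl | inj₂ refl = ⊥-elim (nij refl)

  label-triangle : ∀ (H : Graph n) S a b c → Supp H S → adj H a b ≡ true → adj H a c ≡ true → adj H b c ≡ true → size S ≡ 3 →
          LabelledAt H S a
  label-triangle H S a b c sp ab ac bc e3 = enum₃ a b c , subst (λ t → Labelling H S t (enum₃ a b c)) (sym e3)
    (small-labelling H S 3 (enum₃ a b c) ≤-refl inj ins e3 cmp) , refl
    where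
    G = enum₃ a b c
    cmp : ∀ i j → i < 3 → j < 3 → i ≢ j → adj H (G i) (G j) ≡ true
    cmp i j li lj nij with <3-cases li | <3-cases lj
    ... | inj₁ refl | inj₁ refl = ⊥-elim (nij refl)
    ... | inj₁ refl | inj₂ (inj₁ refl) = ab
    ... | inj₁ refl | inj₂ (inj₂ refl) = ac
    ... | inj₂ (inj₁ refl) | inj₁ refl = adj-sym H ab
    ... | inj₂ (inj₁ refl) | inj₂ (inj₁ refl) = ⊥-elim (nij refl)
    ... | inj₂ (inj₁ refl) | inj₂ (inj₂ refl) = bc
    ... | inj₂ (inj₂ refl) | inj₁ refl = adj-sym H ac
    ... | inj₂ (inj₂ refl) | inj₂ (inj₁ refl) = adj-sym H bc
    ... | inj₂ (inj₂ refl) | inj₂ (inj₂ refl) = ⊥-elim (nij refl)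
    inj : ∀ i j → i < 3 → j < 3 → G i ≡ G j → i ≡ j
    inj i j li lj e with toSum (i ℕ.≟ j)
    ... | inj₁ x = x
    ... | inj₂ nij = ⊥-elim (adj⇒≢ H (cmp i j li lj nij) e)
    ins : ∀ i → i < 3 → S (G i) ≡ true
    ins i li with <3-cases li
    ... | inj₁ refl = sp a b ab
    ... | inj₂ (inj₁ refl) = Supp-target H S sp a b ab
    ... | inj₂ (inj₂ refl) = Supp-target H S sp a c ac

  ≡suc⇒≰0 : ∀ {a b} → a ≡ suc b → a ≤ 0 → ⊥
  ≡suc⇒≰0 refl ()

  label-pendant-case : ∀ f → LabelledBelow f → ∀ (H : Graph n) S → size S ≤ suc f → Supp H S → ¬ HasEvenCycle H → powSum p H ≡ φ (size S) →
           ∀ c → S c ≡ true → deg H c + 1 ≡ size S → ∀ v x → (∀ z → adj H v z ≡ true → z ≡ x) → adj H v x ≡ true →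
           c ≡ v ⊎ c ≢ v → LabelledAt H S c
  label-pendant-case f rec H S le sp ne tight c sc full .c x h ax (inj₁ refl) = label-edge H S c x sp ax (trans (sym full) (cong (_+ 1) (deg≡1 H c x h ax)))
  label-pendant-case f rec H S le sp ne tight c sc full v x h ax (inj₂ cv) = label-pendant f rec H S le sp ne tight c v sc hv' (subst (λ t → adj H v t ≡ true) (sym cx) ax) full
    where
    acv : adj H c v ≡ true
    acv = full⇒adjacent H S c sp sc full v (sp v x ax) (λ e → cv (sym e))
    cx : c ≡ x
    cx = h c (adj-sym H acv)
    hv' : ∀ z → adj H v z ≡ true → z ≡ c
    hv' z e = trans (h z e) (sym cx)

  label-suspended-case : ∀ f → LabelledBelow f → ∀ (H : Graph n) S → size S ≤ suc f → Supp H S → ¬ HasEvenCycle H → powSum p H ≡ φ (size S) →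
       ∀ c → S c ≡ true → deg H c + 1 ≡ size S →
       ∀ u w x y → (∀ z → adj H u z ≡ true → z ≡ w ⊎ z ≡ x) → adj H u w ≡ true → adj H u x ≡ true → w ≢ x →
       (∀ z → adj H w z ≡ true → z ≡ u ⊎ z ≡ y) → adj H w y ≡ true → u ≢ y →
       (Σ ℕ λ k → size (without (without S u) w) ≡ suc k × size S ≡ suc (suc (suc k)) ×
                 powSum p (remove (remove H u) w) ≡ φ (suc k) × deg (remove H u) x ≡ suc k) → LabelledAt H S c
  label-suspended-case f rec H S le sp ne tight c sc full u w x y hu auw aux wx hw awy uy (k , ek , eS , eH2 , d1x) = labelled
    where
    H1 = remove H u
    S1 = without S u
    H2 = remove H1 w
    S2 = without S1 w
    su = sp u w auw
    wu : w ≢ u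
    wu e = adj⇒≢ H auw (sym e)
    xu : x ≢ u
    xu e = adj⇒≢ H aux (sym e)
    wS1 : S1 w ≡ true
    wS1 = without-member S u w (Supp-target H S sp u w auw) wu
    xS1 : S1 x ≡ true
    xS1 = without-member S u x (Supp-target H S sp u x aux) xu
    es1 = size-without S u su
    es2 = size-without S1 w wS1
    sp1 = Supp-remove H S u sp
    sp2 = Supp-remove H1 S1 w sp1
    xfull1 : deg H1 x + 1 ≡ size S1
    xfull1 = trans (cong (_+ 1) d1x) (trans (+-comm (suc k) 1) (sym (trans es2 (cong suc ek))))
    axw1 : adj H1 x w ≡ true
    axw1 = full⇒adjacent H1 S1 x sp1 xS1 xfull1 w wS1 (λ e → wx e)
    xy : x ≡ y
    xy with hw x (adj-sym H (remove-⊆ H u axw1))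
    ... | inj₁ e = ⊥-elim (xu e)
    ... | inj₂ e = e
    awx : adj H w x ≡ true
    awx = subst (λ t → adj H w t ≡ true) (sym xy) awy
    hw' : ∀ z → adj H w z ≡ true → z ≡ u ⊎ z ≡ x
    hw' z e with hw z e
    ... | inj₁ a = inj₁ a
    ... | inj₂ b = inj₂ (trans b (sym xy))
    inS2 : ∀ z → S2 z ≡ true → z ≢ u × z ≢ w
    inS2 z e = neqᵇ⇒≢ (∧≡true⇒ʳ {S z} (∧≡true⇒ˡ {S1 z} e)) , neqᵇ⇒≢ (∧≡true⇒ʳ {S1 z} e)
    rec3 : c ≢ u → c ≢ w → LabelledAt H S c
    rec3 cu cw = res (rec H2 S2 le2 sp2 (noEven-remove H1 w (noEven-remove H u ne)) tight2 c cS2 full2)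
      where
      acu : adj H c u ≡ true
      acu = full⇒adjacent H S c sp sc full u su (λ e → cu (sym e))
      cx : c ≡ x
      cx with hu c (adj-sym H acu)
      ... | inj₁ e = ⊥-elim (cw e)
      ... | inj₂ e = e
      acw : adj H c w ≡ true
      acw = full⇒adjacent H S c sp sc full w (Supp-target H S sp u w auw) (λ e → cw (sym e))
      cS2 : S2 c ≡ true
      cS2 = without-member S1 w c (without-member S u c sc cu) cw
      acw1 : adj H1 c w ≡ true
      acw1 = trans (remove-adj H u cu wu) acw
      dH1 : deg H c ≡ deg H1 c + 1
      dH1 = trans (deg-remove H u c cu) (cong (λ t → deg H1 c + 𝟙 t) acu)
      dH2 : deg H1 c ≡ deg H2 c + 1
      dH2 = trans (deg-remove H1 w c cw) (cong (λ t → deg H2 c + 𝟙 t) acw1)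
      eSS : size S ≡ suc (suc (size S2))
      eSS = trans es1 (cong suc es2)
      full2 : deg H2 c + 1 ≡ size S2
      full2 = suc-injective (suc-injective (trans (lemA (deg H2 c)) (trans (cong (_+ 1) (sym (trans dH1 (cong (_+ 1) dH2)))) (trans full eSS))))
        where lemA : ∀ d → suc (suc (d + 1)) ≡ d + 1 + 1 + 1
              lemA = solve-∀
      le2 : size S2 ≤ f
      le2 = ≤-trans (n≤1+n _) (≤-pred (subst (_≤ suc f) eSS le))
      tight2 : powSum p H2 ≡ φ (size S2)
      tight2 = trans eH2 (cong φ (sym ek))
      aw1c : adj H1 w c ≡ true
      aw1c = trans (remove-adj H u wu cu) (subst (λ t → adj H w t ≡ true) (sym cx) awx)
      res : LabelledAt H2 S2 c → LabelledAt H S c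
      res (g'' , L'' , g0'') = fin (true⊎false {n} (isEven (suc k)))
        where
        L''k : Labelling H2 S2 (suc k) g''
        L''k = subst (λ t → Labelling H2 S2 t g'') ek L''
        hh : ∀ j → j < suc k → adj H1 w (g'' j) ≡ true → g'' j ≡ c
        hh j lj t with hw' (g'' j) (remove-⊆ H u t)
        ... | inj₁ e = ⊥-elim (proj₁ (inS2 (g'' j) (lab-∈ L''k j lj)) e)
        ... | inj₂ e = trans e (sym cx)
        hhu : ∀ j → j < suc k → adj H u (g'' j) ≡ true → g'' j ≡ c
        hhu j lj t with hu (g'' j) t
        ... | inj₁ e = ⊥-elim (proj₂ (inS2 (g'' j) (lab-∈ L''k j lj)) e)
        ... | inj₂ e = trans e (sym cx)
        fin : isEven (suc k) ≡ true ⊎ isEven (suc k) ≡ false → LabelledAt H S c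
        fin (inj₂ odd) = update g1 (suc (suc k)) u , subst (λ t → Labelling H S t (update g1 (suc (suc k)) u)) (sym eS) L ,
                         trans (update-off g1 (suc (suc k)) u 0 (λ ())) (trans (update-off g'' (suc k) w 0 (λ ())) g0'')
          where
          L1 = extend-labelling H1 S1 w (suc k) g'' wS1 L''k
                 (λ j lj → trans (adjacent-only-centre H1 w c (suc k) g'' (lab-inj L''k) g0'' hh aw1c j lj) (sym (friendAdjℕ-odd-below (suc k) j odd lj)))
          g1 = update g'' (suc k) w
          hu1 : ∀ j → j < suc (suc k) → adj H u (g1 j) ≡ friendAdjℕ (suc (suc k)) j
          hu1 j lj with <-suc⇒≡⊎< lj
          ... | inj₁ refl rewrite update-at g'' (suc k) w = trans auw (sym (trans (friendAdjℕ-sym (suc (suc k)) (suc k)) (friendAdjℕ-partner (suc k) odd)))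
          ... | inj₂ l rewrite update-off g'' (suc k) w j (λ e → <-irrefl e l) =
                 trans (adjacent-only-centre H u c (suc k) g'' (lab-inj L''k) g0'' hhu (adj-sym H acu) j l) (sym (friendAdjℕ-partner-below (suc k) j odd l))
          L = extend-labelling H S u (suc (suc k)) g1 su L1 hu1
        fin (inj₁ evn) with isEven-suc⇒suc k evn
        ... | k' , eqk = label-pendant f rec H S le sp ne tight c z sc hz azc full
          where
          L3 : Labelling H2 S2 (suc (suc k')) g''
          L3 = subst (λ t → Labelling H2 S2 (suc t) g'') eqk L''k
          evk' : isEven (suc k') ≡ false
          evk' = subst (λ t → isEven t ≡ false) eqk (isEven-pred-of-even k evn)
          z = g'' (suc k')
          zS2 = lab-∈ L3 (suc k') ≤-refl
          zu = proj₁ (inS2 z zS2)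
          zw = proj₂ (inS2 z zS2)
          zc : z ≢ c
          zc e with lab-inj L3 (suc k') 0 ≤-refl (s≤s z≤n) (trans e (sym g0''))
          ... | ()
          keepZ : ∀ b → b ≢ u → b ≢ w → adj H2 z b ≡ adj H z b
          keepZ b bu bw = trans (remove-adj H1 w zw bw) (remove-adj H u zu bu)
          hz : ∀ b → adj H z b ≡ true → b ≡ c
          hz b e with toSum (b ≟ u)
          ... | inj₁ refl with hu z (adj-sym H e)
          ...   | inj₁ zw' = ⊥-elim (zw zw')
          ...   | inj₂ zx = ⊥-elim (zc (trans zx (sym cx)))
          hz b e | inj₂ bu with toSum (b ≟ w)
          ... | inj₁ refl with hw' z (adj-sym H e)
          ...   | inj₁ zu' = ⊥-elim (zu zu')
          ...   | inj₂ zx = ⊥-elim (zc (trans zx (sym cx)))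
          hz b e | inj₂ bu | inj₂ bw = trans (labelled-odd-neighbour H2 S2 g'' k' sp2 L3 evk' b (trans (keepZ b bu bw) e)) g0''
          azc : adj H z c ≡ true
          azc = trans (sym (keepZ c cu cw)) (subst (λ t → adj H2 z t ≡ true) g0'' (lab-adj L3 (suc k') 0 ≤-refl (s≤s z≤n)))
    labelled : LabelledAt H S c
    labelled with toSum (c ≟ u)
    ... | inj₁ refl = label-triangle H S c w x sp auw aux awx (trans (sym full) (cong (_+ 1) (deg≡2 H c w x hu auw aux wx)))
    ... | inj₂ cu with toSum (c ≟ w)
    ...   | inj₁ refl = label-triangle H S c u x sp (adj-sym H auw) awx aux
                (trans (sym full) (cong (_+ 1) (deg≡2 H c u x hw' (adj-sym H auw) awx (λ e → xu (sym e)))))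
    ...   | inj₂ cw = rec3 cu cw

  tight⇒labelled : ∀ f → LabelledBelow f
  tight⇒labelled zero H S le sp ne tight c sc full = ⊥-elim (≡suc⇒≰0 (size-without S c sc) le)
  tight⇒labelled (suc f) H S le sp ne tight c sc full = byConfig (Configurations.configuration H S sp ne c sc)
    where
    byConfig : Configurations.Configuration H S sp ne → LabelledAt H S c
    byConfig (Configurations.isolated v sv h) = label-singleton H S c sc (tight-isolated H S sp ne tight v sv h)
    byConfig (Configurations.pendant v x h ax) = label-pendant-case f (tight⇒labelled f) H S le sp ne tight c sc full v x h ax (toSum (c ≟ v))
    byConfig (Configurations.suspended u w x y hu auw aux wx hw awy uy) =
      label-suspended-case f (tight⇒labelled f) H S le sp ne tight c sc full u w x y hu auw aux wx hw awy uy (tight-suspended H S sp ne tight u w x y hu auw aux wx hw awy uy)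

toFin : ∀ {n} → ℕ → Fin (suc n)
toFin zero = zero
toFin {zero} (suc i) = zero
toFin {suc n} (suc i) = suc (toFin {n} i)

toℕ-toFin : ∀ {n} i → i < suc n → toℕ (toFin {n} i) ≡ i
toℕ-toFin zero _ = refl
toℕ-toFin {zero} (suc i) (s≤s ())
toℕ-toFin {suc n} (suc i) (s≤s lt) = cong suc (toℕ-toFin i lt)

toFin-toℕ : ∀ {n} (a : Fin (suc n)) → toFin {n} (toℕ a) ≡ a
toFin-toℕ zero = refl
toFin-toℕ {suc n} (suc a) = cong suc (toFin-toℕ a)

friendship-labelling : ∀ n → Labelling (friendship (suc n)) (λ _ → true) (suc n) (toFin {n})
friendship-labelling n = record
  { lab-inj = λ i j li lj e → trans (sym (toℕ-toFin i li)) (trans (cong toℕ e) (toℕ-toFin j lj))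
  ; lab-∈ = λ _ _ → refl
  ; lab-onto = λ a _ → toℕ a , toℕ<n a , toFin-toℕ a
  ; lab-adj = λ i j li lj → trans (friendAdj≡friendAdjℕ (toFin i) (toFin j)) (cong₂ friendAdjℕ (toℕ-toFin i li) (toℕ-toFin j lj)) }

labelling⇒≅ : ∀ n (G : Graph (suc n)) g → Labelling G (λ _ → true) (suc n) g → G ≅ friendship (suc n)
labelling⇒≅ n G g L = σ , prop
  where
  idx : Fin (suc n) → ℕ
  idx a = proj₁ (lab-onto L a refl)
  idx< : ∀ a → idx a < suc n
  idx< a = proj₁ (proj₂ (lab-onto L a refl))
  gidx : ∀ a → g (idx a) ≡ a
  gidx a = proj₂ (proj₂ (lab-onto L a refl))
  to : Fin (suc n) → Fin (suc n)
  to a = toFin (idx a)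
  from : Fin (suc n) → Fin (suc n)
  from i = g (toℕ i)
  invˡ : ∀ y → to (from y) ≡ y
  invˡ y = trans (cong toFin (lab-inj L _ _ (idx< (g (toℕ y))) (toℕ<n y) (gidx (g (toℕ y))))) (toFin-toℕ y)
  invʳ : ∀ x → from (to x) ≡ x
  invʳ x = trans (cong g (toℕ-toFin (idx x) (idx< x))) (gidx x)
  σ : Fin (suc n) ↔ Fin (suc n)
  σ = mk↔ₛ′ to from invˡ invʳ
  prop : ∀ i j → adj G i j ≡ adj (friendship (suc n)) (Inverse.to σ i) (Inverse.to σ j)
  prop i j = trans (cong₂ (adj G) (sym (gidx i)) (sym (gidx j)))
             (trans (lab-adj L (idx i) (idx j) (idx< i) (idx< j))
             (sym (trans (friendAdj≡friendAdjℕ (to i) (to j)) (cong₂ friendAdjℕ (toℕ-toFin (idx i) (idx< i)) (toℕ-toFin (idx j) (idx< j))))))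

⌊n/2⌋-cases : ∀ x → x ≡ ⌊ x /2⌋ + ⌊ x /2⌋ ⊎ x ≡ suc (⌊ x /2⌋ + ⌊ x /2⌋)
⌊n/2⌋-cases zero = inj₁ refl
⌊n/2⌋-cases (suc zero) = inj₂ refl
⌊n/2⌋-cases (suc (suc x)) with ⌊n/2⌋-cases x
... | inj₁ e = inj₁ (cong suc (trans (cong suc e) (sym (+-suc (⌊ x /2⌋) (⌊ x /2⌋)))))
... | inj₂ e = inj₂ (cong suc (trans (cong suc e) (cong suc (sym (+-suc (⌊ x /2⌋) (⌊ x /2⌋))))))

no-three-halves : ∀ x y z → ⌊ x /2⌋ ≡ ⌊ y /2⌋ → ⌊ y /2⌋ ≡ ⌊ z /2⌋ → x ≢ y → y ≢ z → x ≢ z → ⊥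
no-three-halves x y z exy eyz nxy nyz nxz with ⌊n/2⌋-cases x | ⌊n/2⌋-cases y | ⌊n/2⌋-cases z
... | inj₁ ex | inj₁ ey | _ = nxy (trans ex (trans (cong₂ _+_ exy exy) (sym ey)))
... | inj₂ ex | inj₂ ey | _ = nxy (trans ex (trans (cong suc (cong₂ _+_ exy exy)) (sym ey)))
... | inj₁ ex | inj₂ ey | inj₁ ez = nxz (trans ex (trans (cong₂ _+_ (trans exy eyz) (trans exy eyz)) (sym ez)))
... | inj₁ ex | inj₂ ey | inj₂ ez = nyz (trans ey (trans (cong suc (cong₂ _+_ eyz eyz)) (sym ez)))
... | inj₂ ex | inj₁ ey | inj₁ ez = nyz (trans ey (trans (cong₂ _+_ eyz eyz) (sym ez)))
... | inj₂ ex | inj₁ ey | inj₂ ez = nxz (trans ex (trans (cong suc (cong₂ _+_ (trans exy eyz) (trans exy eyz))) (sym ez)))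

friendAdjℕ-leaves : ∀ a b → a ≢ 0 → b ≢ 0 → friendAdjℕ a b ≡ true → ⌊ a ∸ 1 /2⌋ ≡ ⌊ b ∸ 1 /2⌋ × a ≢ b
friendAdjℕ-leaves a b na nb e rewrite ≢⇒eqᵇ-false na | ≢⇒eqᵇ-false nb with toSum (a ℕ.≟ b)
... | inj₁ refl rewrite eqᵇ-refl a = ⊥-elim (false≢true e)
... | inj₂ ne rewrite ≢⇒eqᵇ-false ne = eqᵇ⇒≡ e , ne

pred-ne : ∀ {a b} → a ≢ 0 → b ≢ 0 → a ≢ b → a ∸ 1 ≢ b ∸ 1
pred-ne {zero} na _ _ _ = na refl
pred-ne {suc a} {zero} _ nb _ _ = nb refl
pred-ne {suc a} {suc b} _ _ ne e = ne (cong suc e)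

no-leaf-path : ∀ a b c → a ≢ 0 → b ≢ 0 → c ≢ 0 → friendAdjℕ a b ≡ true → friendAdjℕ b c ≡ true → a ≢ c → ⊥
no-leaf-path a b c na nb nc e1 e2 nac with friendAdjℕ-leaves a b na nb e1 | friendAdjℕ-leaves b c nb nc e2
... | h1 , nab | h2 , nbc = no-three-halves (a ∸ 1) (b ∸ 1) (c ∸ 1) h1 h2 (pred-ne na nb nab) (pred-ne nb nc nbc) (pred-ne na nc nac)

module _ {n : ℕ} where
  F = friendship n

  -- A leaf of F_n has at most one neighbour other than the centre, and a cycle passes the centre
  -- at most once, so every cycle of F_n is a triangle.
  no-leaf-path-F : ∀ (a b c : Fin n) → toℕ a ≢ 0 → toℕ b ≢ 0 → toℕ c ≢ 0 → adj F a b ≡ true → adj F b c ≡ true → a ≢ c → ⊥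
  no-leaf-path-F a b c na nb nc e1 e2 nac = no-leaf-path (toℕ a) (toℕ b) (toℕ c) na nb nc
    (trans (sym (friendAdj≡friendAdjℕ a b)) e1) (trans (sym (friendAdj≡friendAdjℕ b c)) e2) (λ e → nac (toℕ-injective e))

  module CycleIn {m} (c : Cycle F m) where
    V = Cycle.vert c
    zu : ∀ i j → toℕ (V i) ≡ 0 → toℕ (V j) ≡ 0 → i ≡ j
    zu i j zi zj = Cycle.inj c (toℕ-injective (trans zi (sym zj)))
    nzv : ∀ i j → toℕ (V j) ≡ 0 → ¬ (i ≡ j) → toℕ (V i) ≢ 0
    nzv i j zj ne zi = ne (zu i j zi zj)
    dv : ∀ i j → ¬ (i ≡ j) → V i ≢ V j
    dv i j ne e = ne (Cycle.inj c e)

  no-4-cycle : Cycle F 3 → ⊥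
  no-4-cycle c = body
    where
    open CycleIn c
    k0 k1 k2 k3 : Fin 4
    k0 = zero
    k1 = suc zero
    k2 = suc (suc zero)
    k3 = suc (suc (suc zero))
    e01 = Cycle.step c zero
    e12 = Cycle.step c (suc zero)
    e23 = Cycle.step c (suc (suc zero))
    e30 = Cycle.close c
    body : ⊥
    body with toSum (toℕ (V k1) ℕ.≟ 0)
    ... | inj₁ z1 = no-leaf-path-F (V k2) (V k3) (V k0) (nzv k2 k1 z1 (λ ())) (nzv k3 k1 z1 (λ ())) (nzv k0 k1 z1 (λ ())) e23 e30 (dv k2 k0 (λ ()))
    ... | inj₂ n1 with toSum (toℕ (V k2) ℕ.≟ 0)
    ...   | inj₁ z2 = no-leaf-path-F (V k3) (V k0) (V k1) (nzv k3 k2 z2 (λ ())) (nzv k0 k2 z2 (λ ())) n1 e30 e01 (dv k3 k1 (λ ()))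
    ...   | inj₂ n2 with toSum (toℕ (V k0) ℕ.≟ 0)
    ...     | inj₁ z0 = no-leaf-path-F (V k1) (V k2) (V k3) n1 n2 (nzv k3 k0 z0 (λ ())) e12 e23 (dv k1 k3 (λ ()))
    ...     | inj₂ n0 = no-leaf-path-F (V k0) (V k1) (V k2) n0 n1 n2 e01 e12 (dv k0 k2 (λ ()))

  no-≥5-cycle-centre-at-2 : ∀ m (c : Cycle F (suc (suc (suc (suc m))))) → let V = Cycle.vert c in
          toℕ (V (suc (suc (suc zero)))) ≢ 0 → toℕ (V (suc (suc (suc (suc zero))))) ≢ 0 → toℕ (V (suc (suc zero))) ≡ 0 → ⊥
  no-≥5-cycle-centre-at-2 zero c n3 n4 z2 = no-leaf-path-F (V (suc (suc (suc zero)))) (V (suc (suc (suc (suc zero))))) (V zero) n3 n4 (nzv zero (suc (suc zero)) z2 (λ ()))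
        (Cycle.step c (suc (suc (suc zero)))) (Cycle.close c) (dv (suc (suc (suc zero))) zero (λ ()))
    where open CycleIn c
  no-≥5-cycle-centre-at-2 (suc m') c n3 n4 z2 = no-leaf-path-F (V (suc (suc (suc zero)))) (V (suc (suc (suc (suc zero))))) (V k5) n3 n4 (nzv k5 (suc (suc zero)) z2 (λ ()))
        (Cycle.step c (suc (suc (suc zero)))) (Cycle.step c (suc (suc (suc (suc zero))))) (dv (suc (suc (suc zero))) k5 (λ ()))
    where open CycleIn c
          k5 : Fin (suc (suc (suc (suc (suc (suc m'))))))
          k5 = suc (suc (suc (suc (suc zero))))

  no-≥5-cycle : ∀ m → Cycle F (suc (suc (suc (suc m)))) → ⊥
  no-≥5-cycle m c = body
    where
    open CycleIn c
    k0 k1 k2 k3 k4 : Fin (suc (suc (suc (suc (suc m)))))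
    k0 = zero
    k1 = suc zero
    k2 = suc (suc zero)
    k3 = suc (suc (suc zero))
    k4 = suc (suc (suc (suc zero)))
    e01 = Cycle.step c zero
    e12 = Cycle.step c (suc zero)
    e23 = Cycle.step c (suc (suc zero))
    e34 = Cycle.step c (suc (suc (suc zero)))
    last = no-≥5-cycle-centre-at-2 m c
    body : ⊥
    body with toSum (toℕ (V k1) ℕ.≟ 0)
    ... | inj₁ z1 = no-leaf-path-F (V k2) (V k3) (V k4) (nzv k2 k1 z1 (λ ())) (nzv k3 k1 z1 (λ ())) (nzv k4 k1 z1 (λ ())) e23 e34 (dv k2 k4 (λ ()))
    ... | inj₂ n1 with toSum (toℕ (V k2) ℕ.≟ 0)
    ...   | inj₁ z2 = last (nzv k3 k2 z2 (λ ())) (nzv k4 k2 z2 (λ ())) z2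
    ...   | inj₂ n2 with toSum (toℕ (V k0) ℕ.≟ 0)
    ...     | inj₁ z0 = no-leaf-path-F (V k1) (V k2) (V k3) n1 n2 (nzv k3 k0 z0 (λ ())) e12 e23 (dv k1 k3 (λ ()))
    ...     | inj₂ n0 = no-leaf-path-F (V k0) (V k1) (V k2) n0 n1 n2 e01 e12 (dv k0 k2 (λ ()))

  friendship-noEvenCycle : ¬ HasEvenCycle F
  friendship-noEvenCycle (zero , _ , c) with Cycle.len≥3 c
  ... | ()
  friendship-noEvenCycle (suc zero , _ , c) with Cycle.len≥3 c
  ... | s≤s ()
  friendship-noEvenCycle (suc (suc zero) , divides q e , c) = odd3 q e
    where
    odd3 : ∀ q → 3 ≡ q * 2 → ⊥
    odd3 zero ()
    odd3 (suc zero) ()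
    odd3 (suc (suc q)) ()
  friendship-noEvenCycle (suc (suc (suc zero)) , _ , c) = no-4-cycle c
  friendship-noEvenCycle (suc (suc (suc (suc m))) , _ , c) = no-≥5-cycle m c

module Extremal (q n' : ℕ) where
  n = suc n'
  open Exponent q
  open UpperBound q {n}
  open Tightness q {n}
  open LabelledValue q {n}
  open Uniqueness q {n}

  everything : Fin n → Bool
  everything _ = true

  size-everything : size everything ≡ n
  size-everything = ∑-ones n

  Supp-everything : ∀ (H : Graph n) → Supp H everything
  Supp-everything H _ _ _ = refl

  powSum-friendship : powSum p (friendship n) ≡ φ n
  powSum-friendship = labelled⇒powSum≡φ n (friendship n) everything toFin (Supp-everything (friendship n)) (friendship-labelling n')

  degPow≤friendship : ∀ (G : Graph n) → ¬ HasEvenCycle G → degPow p G ≤ degPow p (friendship n)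
  degPow≤friendship G ne = subst₂ _≤_ (sym (degPow≡powSum p G)) (sym (trans (degPow≡powSum p (friendship n)) powSum-friendship))
     (subst (λ t → powSum p G ≤ φ t) size-everything (powSum≤φ G everything (Supp-everything G) ne))

  tight-everything : ∀ (G : Graph n) → degPow p G ≡ degPow p (friendship n) → powSum p G ≡ φ (size everything)
  tight-everything G eq = trans (sym (degPow≡powSum p G)) (trans eq (trans (degPow≡powSum p (friendship n)) (trans powSum-friendship (cong φ (sym size-everything)))))

  HasFullVertex : Graph n → Set
  HasFullVertex G = Σ (Fin n) λ c → deg G c + 1 ≡ size everything

  full-from-pendant : ∀ (G : Graph n) v x → adj G v x ≡ true →
          (Σ ℕ λ k → size (without everything v) ≡ suc k × powSum p (remove G v) ≡ φ (suc k) × deg (remove G v) x ≡ k × isEven k ≡ true) → HasFullVertex G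
  full-from-pendant G v x ax (k , ek , eH' , dk , evk) = x , trans (cong (_+ 1) dx) (trans (+-comm (suc k) 1) (sym (trans (size-without everything v refl) (cong suc ek))))
    where
    dx : deg G x ≡ suc k
    dx = trans (deg-remove G v x (λ e → adj⇒≢ G ax (sym e))) (trans (cong₂ (λ a b → a + 𝟙 b) dk (trans (adj-comm G x v) ax)) (+-comm k 1))

  full-from-suspended : ∀ (G : Graph n) u w x → adj G u x ≡ true →
          (Σ ℕ λ k → size (without (without everything u) w) ≡ suc k × size everything ≡ suc (suc (suc k)) ×
                 powSum p (remove (remove G u) w) ≡ φ (suc k) × deg (remove G u) x ≡ suc k) → HasFullVertex G
  full-from-suspended G u w x aux (k , ek , eS , eH2 , d1x) = x , trans (cong (_+ 1) dx) (trans (+-comm (suc (suc k)) 1) (sym eS))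
    where
    dx : deg G x ≡ suc (suc k)
    dx = trans (deg-remove G u x (λ e → adj⇒≢ G aux (sym e))) (trans (cong₂ (λ a b → a + 𝟙 b) d1x (trans (adj-comm G x u) aux)) (+-comm (suc k) 1))

  tight⇒full : ∀ (G : Graph n) → 2 ≤ n → (ne : ¬ HasEvenCycle G) → powSum p G ≡ φ (size everything) → HasFullVertex G
  tight⇒full G le ne tight = byC (Configurations.configuration G everything (Supp-everything G) ne zero refl)
    where
    byC : Configurations.Configuration G everything (Supp-everything G) ne → HasFullVertex G
    byC (Configurations.isolated v sv h) = ⊥-elim (<-irrefl (sym (trans (sym size-everything) (tight-isolated G everything (Supp-everything G) ne tight v sv h))) le)
    byC (Configurations.pendant v x h ax) = full-from-pendant G v x ax (tight-pendant G everything (Supp-everything G) ne tight v x h ax)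
    byC (Configurations.suspended u w x y hu auw aux wx hw awy uy) = full-from-suspended G u w x aux (tight-suspended G everything (Supp-everything G) ne tight u w x y hu auw aux wx hw awy uy)

  degPow≡friendship⇒≅ : 2 ≤ n → ∀ (G : Graph n) → ¬ HasEvenCycle G → degPow p G ≡ degPow p (friendship n) → G ≅ friendship n
  degPow≡friendship⇒≅ le G ne eq = labelling⇒≅ n' G g (subst (λ t → Labelling G everything t g) size-everything L)
    where
    tight = tight-everything G eq
    fc = tight⇒full G le ne tight
    r = tight⇒labelled (size everything) G everything ≤-refl (Supp-everything G) ne tight (proj₁ fc) refl (proj₂ fc)
    g = proj₁ r
    L = proj₁ (proj₂ r)

corollary1 : (p : ℕ) → 1 < p → (n : ℕ) → 4 ≤ n →
    (¬ HasEvenCycle (friendship n))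
    × ((G : Graph n) → ¬ HasEvenCycle G → degPow p G ≤ degPow p (friendship n))
    × ((G : Graph n) → ¬ HasEvenCycle G → degPow p G ≡ degPow p (friendship n) → G ≅ friendship n)
-- The hypothesis 4 ≤ n is only needed as 2 ≤ n.
corollary1 (suc (suc q)) (s≤s (s≤s _)) (suc n') 4≤n =
    friendship-noEvenCycle
  , Extremal.degPow≤friendship q n'
  , Extremal.degPow≡friendship⇒≅ q n' (≤-trans (s≤s (s≤s z≤n)) 4≤n)
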